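{- Let $\Gamma$ be a finite simple graph on $n$ vertices which is not complete, and let $G\le\mathrm{Aut}(\Gamma)$ be such that $(\Gamma,G)$ is a reciprocal pair. Then $\Gamma$ has at most $\frac{(n-1)^2}{2}$ edges.
   Context: $F_G(x)=\sum_{g\in G}x^{c(g)}$, $c(g)$ the number of cycles of $g$ on vertices. For $g\in\mathrm{Aut}(\Gamma)$, $\Gamma/g$ has the cycles of $g$ as vertices, two (possibly equal, giving a loop) joined if an edge of $\Gamma$ joins vertices in them; $P_{\Gamma/g}$ is its chromatic polynomial ($0$ if there is a loop). $P_{\Gamma,G}(x)=\sum_{g\in G}P_{\Gamma/g}(x)$. $(\Gamma,G)$ is a reciprocal pair if $P_{\Gamma,G}(x)=(-1)^nF_G(-x)$. -}

module Defs where

open import Data.Nat using (ℕ; zero; suc; _≤ᵇ_)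
open import Data.Bool using (Bool; true; false; _∧_; _∨_; not)
open import Data.Fin using (Fin; toℕ; _≟_)
open import Data.Fin.Permutation using (Permutation′; _⟨$⟩ʳ_; id; _∘ₚ_)
open import Data.List using (List; []; _∷_; [_]; map; concatMap; filter; length; allFin; foldr)
open import Data.Bool.ListAction using (any; all)
open import Data.Bool.Properties using (T?)
open import Data.List.Relation.Unary.All using (All)
open import Data.List.Relation.Unary.Any using (Any)
open import Data.List.Relation.Unary.AllPairs using (AllPairs)
open import Data.Vec using (Vec; lookup) renaming ([] to []ᵥ; _∷_ to _∷ᵥ_)
open import Data.Integer using (ℤ; +_; -_; _*_; _+_) renaming (_^_ to _^ℤ_)
open import Relation.Binary.PropositionalEquality using (_≡_; _≢_)
open import Relation.Nullary using (¬_)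
open import Relation.Nullary.Decidable using (⌊_⌋)
open import Data.Product using (Σ; _×_; ∃)

record Graph (n : ℕ) : Set where
  field
    adj     : Fin n → Fin n → Bool
    adj-sym : ∀ i j → adj i j ≡ adj j i
    irrefl  : ∀ i → adj i i ≡ false
open Graph public

_==_ : ∀ {n} → Fin n → Fin n → Bool
i == j = ⌊ i ≟ j ⌋

NotComplete : ∀ {n} → Graph n → Set
NotComplete {n} Γ = Σ (Fin n) λ i → Σ (Fin n) λ j → (i ≢ j) × (adj Γ i j ≡ false)

numEdges : ∀ {n} → Graph n → ℕ
numEdges {n} Γ =
  length (filter (λ p → T? p)
    (concatMap (λ i → map (λ j → (toℕ i Data.Nat.<ᵇ toℕ j) ∧ adj Γ i j) (allFin n)) (allFin n)))

Perm : ℕ → Set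
Perm n = Permutation′ n

_≈ₚ_ : ∀ {n} → Perm n → Perm n → Set
σ ≈ₚ τ = ∀ i → σ ⟨$⟩ʳ i ≡ τ ⟨$⟩ʳ i

IsAut : ∀ {n} → Graph n → Perm n → Set
IsAut Γ σ = ∀ i j → adj Γ (σ ⟨$⟩ʳ i) (σ ⟨$⟩ʳ j) ≡ adj Γ i j

-- A finite subgroup of Aut(Γ), given as the duplicate-free list of its
-- elements (equality of permutations = pointwise equality).  A nonempty
-- finite subset of a group closed under composition is a subgroup; we
-- additionally require the identity to be present.
record IsAutSubgroup {n : ℕ} (Γ : Graph n) (G : List (Perm n)) : Set where
  field
    all-aut  : All (IsAut Γ) G
    has-id   : Any (_≈ₚ id) G
    closed   : All (λ σ → All (λ τ → Any (_≈ₚ (σ ∘ₚ τ)) G) G) G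
    distinct : AllPairs (λ σ τ → ¬ (σ ≈ₚ τ)) G
open IsAutSubgroup public

iter : ∀ {n} → Perm n → ℕ → Fin n → Fin n
iter σ zero    i = i
iter σ (suc k) i = σ ⟨$⟩ʳ iter σ k i

upTo : ℕ → List ℕ
upTo zero    = []
upTo (suc k) = upTo k Data.List.++ [ k ]

-- j lies in the cycle of σ through i  (j = σ^k i for some k < n;
-- every cycle has length ≤ n, so this is the full cycle)
sameCycle : ∀ {n} → Perm n → Fin n → Fin n → Bool
sameCycle {n} σ i j = any (λ k → iter σ k i == j) (upTo n)

isCycleRep : ∀ {n} → Perm n → Fin n → Bool
isCycleRep {n} σ i = all (λ j → not (sameCycle σ i j) ∨ (toℕ i ≤ᵇ toℕ j)) (allFin n)

numCycles : ∀ {n} → Perm n → ℕ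
numCycles {n} σ = length (filter (λ i → T? (isCycleRep σ i)) (allFin n))

-- adjacency in Γ/σ of the cycle containing u and the cycle containing v
-- (u, v in the same cycle and adjacent means a loop)
quotAdj : ∀ {n} → Graph n → Perm n → Fin n → Fin n → Bool
quotAdj {n} Γ σ u v =
  any (λ u' → any (λ v' → sameCycle σ u u' ∧ sameCycle σ v v' ∧ adj Γ u' v') (allFin n)) (allFin n)

allMaps : (x n : ℕ) → List (Vec (Fin x) n)
allMaps x zero    = [ []ᵥ ]
allMaps x (suc n) = concatMap (λ c → map (c ∷ᵥ_) (allMaps x n)) (allFin x)

-- A colouring of the vertices of Γ/σ (= cycles of σ) with x colours is
-- represented by the map on Fin n that is constant on cycles.  It is
-- proper if adjacent vertices of Γ/σ get different colours; if Γ/σ has a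
-- loop there is no proper colouring.
properQuot : ∀ {n x} → Graph n → Perm n → Vec (Fin x) n → Bool
properQuot {n} Γ σ c =
  all (λ i → lookup c (σ ⟨$⟩ʳ i) == lookup c i) (allFin n)
  ∧ all (λ u → all (λ v → not (quotAdj Γ σ u v) ∨ not (lookup c u == lookup c v)) (allFin n)) (allFin n)

chromQuot : ∀ {n} → Graph n → Perm n → ℕ → ℕ
chromQuot {n} Γ σ x = length (filter (λ c → T? (properQuot Γ σ c)) (allMaps x n))

chromPair : ∀ {n} → Graph n → List (Perm n) → ℕ → ℕ
chromPair Γ G x = foldr (λ g s → chromQuot Γ g x Data.Nat.+ s) 0 G

cycleIndexF : ∀ {n} → List (Perm n) → ℤ → ℤ
cycleIndexF G y = foldr (λ g s → (y ^ℤ numCycles g) + s) (+ 0) G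

-- (Γ, G) is a reciprocal pair: P_{Γ,G}(x) = (-1)^n F_G(-x) as polynomials,
-- i.e. (both sides being polynomials in x) equality at every x ∈ ℕ.
Reciprocal : ∀ {n} → Graph n → List (Perm n) → Set
Reciprocal {n} Γ G = ∀ (x : ℕ) → + chromPair Γ G x ≡ ((- + 1) ^ℤ n) * cycleIndexF G (- (+ x))

-- Compare the coefficients of xⁿ⁻¹ in P_{Γ,G}(x) = (−1)ⁿ F_G(−x). Only the identity and the
-- transpositions of G reach degree n − 1: the identity contributes −|E| on the left and nothing on the
-- right, a transposition (i j) contributes [ij ∉ E] on the left (Γ/(i j) has a loop otherwise) and −1 on
-- the right. So 2|E| is at most the number of ordered pairs i ≠ j whose transposition is an automorphism,
-- each weighted by 1 + [ij ∉ E]. Without polynomials, the comparison is made by evaluating at one large x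
-- and bounding all terms of lower degree.
-- With N ordered non-adjacent pairs, that bound says that at most 2N ordered pairs have a transposition
-- which is not an automorphism. Exchanging a universal and a non-universal vertex never is one, so for u
-- universal and d ≥ 1 non-universal vertices N ≥ u d, and N ≥ d trivially; hence N ≥ u + d − 1 = n − 1
-- and 2|E| = n(n − 1) − N ≤ (n − 1)².

module Submission where

open import Defs
open import Data.Nat using (ℕ; zero; suc; _+_; _*_; _∸_; _^_; _≤_; _<_; z≤n; s≤s; _<ᵇ_; NonZero; >-nonZero)
open import Data.Nat.Properties hiding (_≟_)
open import Data.Nat.DivMod using (_%_; _/_; m≡m%n+[m/n]*n; m%n<n)
open import Data.Nat.Tactic.RingSolver using (solve-∀)
open import Data.Integer as ℤ using (ℤ; +_; -_; +≤+)
import Data.Integer.Properties as ℤ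
open import Data.Bool using (Bool; true; false; _∧_; _∨_; not; T)
import Data.Bool as Bool
open import Data.Bool.Properties using (T?; T-∧; ∧-zeroʳ)
open import Data.List using (List; []; _∷_; _++_; map; concatMap; filter; length; allFin)
open import Data.List.Properties using (map-tabulate; length-tabulate)
open import Data.List.Membership.Propositional using (_∈_; lose; find)
open import Data.List.Membership.Propositional.Properties using (∈-allFin; ∈-++⁺ˡ; ∈-++⁺ʳ; ∈-++⁻)
open import Data.List.Relation.Unary.All as All using (All; []; _∷_)
open import Data.List.Relation.Unary.All.Properties using (all⁺; all⁻; tabulate⁺)
open import Data.List.Relation.Unary.Any using (Any; here; there)
open import Data.List.Relation.Unary.Any.Properties using (any⁺; any⁻)
open import Data.List.Relation.Unary.AllPairs using (AllPairs; []; _∷_)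
open import Data.Fin using (Fin; toℕ; _≟_; punchOut) renaming (zero to fzero; suc to fsuc)
open import Data.Fin.Properties using (all?; any?; ¬∀⟶∃¬; pigeonhole; toℕ<n; toℕ-injective; punchIn-punchOut; punchOut-injective) renaming (suc-injective to fsuc-injective)
open import Data.Fin.Permutation using (_⟨$⟩ʳ_; _⟨$⟩ˡ_; inverseˡ; transpose; id)
open import Data.Vec using (Vec; lookup; insertAt; _∷_)
open import Data.Vec.Properties using (insertAt-lookup; insertAt-punchIn)
open import Data.Product using (∃; _×_; _,_; proj₁; proj₂)
open import Data.Sum using (_⊎_; inj₁; inj₂)
open import Data.Empty using (⊥-elim)
open import Function using (_∘_; _⇔_; mk⇔; Equivalence)
open import Relation.Binary.PropositionalEquality
open import Relation.Binary.Definitions using (tri<; tri≈; tri>)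
open import Relation.Nullary using (¬_; Dec; yes; no; ¬?; _×-dec_; _→-dec_)
open import Relation.Nullary.Decidable using (⌊_⌋; dec-true; dec-false; does-⇔; isYes≗does; toWitness; fromWitness)
import Algebra.Properties.CommutativeSemigroup as CommutativeSemigroupProperties
open CommutativeSemigroupProperties +-commutativeSemigroup using (interchange)

𝟙 : Bool → ℕ
𝟙 true  = 1
𝟙 false = 0

𝟙≤1 : ∀ b → 𝟙 b ≤ 1
𝟙≤1 true  = ≤-refl
𝟙≤1 false = z≤n

𝟙-∧ : ∀ a b → 𝟙 (a ∧ b) ≡ 𝟙 a * 𝟙 b
𝟙-∧ true  b = sym (+-identityʳ (𝟙 b))
𝟙-∧ false b = refl

𝟙-not : ∀ a → 𝟙 (not a) + 𝟙 a ≡ 1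
𝟙-not true  = refl
𝟙-not false = refl

𝟙-idem : ∀ a → 𝟙 a * 𝟙 a ≡ 𝟙 a
𝟙-idem true  = refl
𝟙-idem false = refl

𝟙-*-≤ : ∀ b k → 𝟙 b * k ≤ k
𝟙-*-≤ true  k = ≤-reflexive (+-identityʳ k)
𝟙-*-≤ false k = z≤n

𝟙-mono : ∀ {a b} → (T a → T b) → 𝟙 a ≤ 𝟙 b
𝟙-mono {false}         h = z≤n
𝟙-mono {true}  {true}  h = ≤-refl
𝟙-mono {true}  {false} h = ⊥-elim (h _)

𝟙-T : ∀ {b} → T b → 𝟙 b ≡ 1
𝟙-T {true} _ = refl

𝟙-¬T : ∀ {b} → ¬ T b → 𝟙 b ≡ 0
𝟙-¬T {false} _ = refl
𝟙-¬T {true}  h = ⊥-elim (h _)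

𝟙-not-¬T : ∀ {b} → ¬ T b → 𝟙 (not b) ≡ 1
𝟙-not-¬T {false} _ = refl
𝟙-not-¬T {true}  h = ⊥-elim (h _)

𝟙? : ∀ {P : Set} → Dec P → ℕ
𝟙? d = 𝟙 ⌊ d ⌋

𝟙?-yes : ∀ {P : Set} (d : Dec P) → P → 𝟙? d ≡ 1
𝟙?-yes (yes _) _ = refl
𝟙?-yes (no ¬p) p = ⊥-elim (¬p p)

𝟙?-no : ∀ {P : Set} (d : Dec P) → ¬ P → 𝟙? d ≡ 0
𝟙?-no (yes p) ¬p = ⊥-elim (¬p p)
𝟙?-no (no _)  _  = refl

T-not⇒¬T : ∀ {b} → T (not b) → ¬ T b
T-not⇒¬T {true} ()

T-not-∨ : ∀ {a b} → T (not a ∨ b) ⇔ (T a → T b)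
T-not-∨ {true}  = mk⇔ (λ b _ → b) (λ f → f _)
T-not-∨ {false} = mk⇔ (λ _ ()) _

∑ : {A : Set} → List A → (A → ℕ) → ℕ
∑ []       f = 0
∑ (a ∷ as) f = f a + ∑ as f

syntax ∑ L (λ a → e) = ∑[ a ∈ L ] e

module _ {A : Set} where

  ∑-cong : ∀ (L : List A) {f g : A → ℕ} → (∀ a → f a ≡ g a) → ∑ L f ≡ ∑ L g
  ∑-cong []      e = refl
  ∑-cong (a ∷ L) e = cong₂ _+_ (e a) (∑-cong L e)

  ∑-mono : ∀ (L : List A) {f g : A → ℕ} → (∀ a → f a ≤ g a) → ∑ L f ≤ ∑ L g
  ∑-mono []      e = z≤n
  ∑-mono (a ∷ L) e = +-mono-≤ (e a) (∑-mono L e)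

  ∑-zero : ∀ (L : List A) (f : A → ℕ) → (∀ a → f a ≡ 0) → ∑ L f ≡ 0
  ∑-zero []      f e = refl
  ∑-zero (a ∷ L) f e rewrite e a = ∑-zero L f e

  ∑-All-zero : ∀ (L : List A) (f : A → ℕ) → All (λ a → f a ≡ 0) L → ∑ L f ≡ 0
  ∑-All-zero []      f []       = refl
  ∑-All-zero (a ∷ L) f (p ∷ ps) rewrite p = ∑-All-zero L f ps

  1≤∑ : ∀ {P : A → Set} (L : List A) (f : A → ℕ) → Any P L → (∀ {a} → P a → 1 ≤ f a) → 1 ≤ ∑ L f
  1≤∑ (a ∷ L) f (here p)  h = ≤-trans (h p) (m≤m+n (f a) (∑ L f))
  1≤∑ (a ∷ L) f (there q) h = ≤-trans (1≤∑ L f q h) (m≤n+m (∑ L f) (f a))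

  ∑-distrib-+ : ∀ (L : List A) (f g : A → ℕ) → ∑[ a ∈ L ] (f a + g a) ≡ ∑ L f + ∑ L g
  ∑-distrib-+ []      f g = refl
  ∑-distrib-+ (a ∷ L) f g rewrite ∑-distrib-+ L f g = interchange (f a) (g a) (∑ L f) (∑ L g)

  ∑-*ˡ : ∀ (L : List A) (k : ℕ) (f : A → ℕ) → ∑[ a ∈ L ] (k * f a) ≡ k * ∑ L f
  ∑-*ˡ []      k f = sym (*-zeroʳ k)
  ∑-*ˡ (a ∷ L) k f rewrite ∑-*ˡ L k f = sym (*-distribˡ-+ k (f a) (∑ L f))

  ∑-*ʳ : ∀ (L : List A) (k : ℕ) (f : A → ℕ) → ∑[ a ∈ L ] (f a * k) ≡ ∑ L f * k
  ∑-*ʳ L k f = trans (∑-cong L (λ a → *-comm (f a) k)) (trans (∑-*ˡ L k f) (*-comm k (∑ L f)))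

  ∑-const : ∀ (L : List A) (k : ℕ) → ∑[ _ ∈ L ] k ≡ length L * k
  ∑-const []      k = refl
  ∑-const (a ∷ L) k = cong (_+_ k) (∑-const L k)

  ∑-++ : ∀ (L M : List A) (f : A → ℕ) → ∑ (L ++ M) f ≡ ∑ L f + ∑ M f
  ∑-++ []      M f = refl
  ∑-++ (a ∷ L) M f rewrite ∑-++ L M f = sym (+-assoc (f a) (∑ L f) (∑ M f))

  length-filter : ∀ (p : A → Bool) (L : List A) → length (filter (λ a → T? (p a)) L) ≡ ∑[ a ∈ L ] 𝟙 (p a)
  length-filter p []      = refl
  length-filter p (a ∷ L) with p a
  ... | true  = cong suc (length-filter p L)
  ... | false = length-filter p L

∑-comm : ∀ {A B : Set} (L : List A) (M : List B) (f : A → B → ℕ) →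
  ∑[ a ∈ L ] ∑[ b ∈ M ] f a b ≡ ∑[ b ∈ M ] ∑[ a ∈ L ] f a b
∑-comm []      M f = sym (∑-zero M (λ _ → 0) (λ _ → refl))
∑-comm (a ∷ L) M f rewrite ∑-comm L M f = sym (∑-distrib-+ M (f a) (λ b → ∑[ a ∈ L ] f a b))

∑-map : ∀ {A B : Set} (L : List A) (g : A → B) (f : B → ℕ) → ∑ (map g L) f ≡ ∑ L (f ∘ g)
∑-map []      g f = refl
∑-map (a ∷ L) g f = cong (_+_ (f (g a))) (∑-map L g f)

∑-concatMap : ∀ {A B : Set} (L : List A) (g : A → List B) (f : B → ℕ) →
  ∑ (concatMap g L) f ≡ ∑[ a ∈ L ] ∑ (g a) f
∑-concatMap []      g f = refl
∑-concatMap (a ∷ L) g f = trans (∑-++ (g a) (concatMap g L) f) (cong (_+_ (∑ (g a) f)) (∑-concatMap L g f))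

∑-allFin-suc : ∀ n (f : Fin (suc n) → ℕ) → ∑ (allFin (suc n)) f ≡ f fzero + ∑[ i ∈ allFin n ] f (fsuc i)
∑-allFin-suc n f = cong (_+_ (f fzero)) (trans (cong (λ L → ∑ L f) (sym (map-tabulate (λ i → i) fsuc))) (∑-map (allFin n) fsuc f))

==-refl : ∀ {n} (i : Fin n) → (i == i) ≡ true
==-refl i = trans (isYes≗does (i ≟ i)) (dec-true (i ≟ i) refl)

==-≢ : ∀ {n} {i j : Fin n} → i ≢ j → (i == j) ≡ false
==-≢ {i = i} {j} i≢j = trans (isYes≗does (i ≟ j)) (dec-false (i ≟ j) i≢j)

==-sym : ∀ {n} (i j : Fin n) → (i == j) ≡ (j == i)
==-sym i j = trans (isYes≗does (i ≟ j)) (trans (does-⇔ (mk⇔ sym sym) (i ≟ j) (j ≟ i)) (sym (isYes≗does (j ≟ i))))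

==-suc : ∀ {n} (i j : Fin n) → (fsuc i == fsuc j) ≡ (i == j)
==-suc i j = trans (isYes≗does (fsuc i ≟ fsuc j)) (trans (does-⇔ (mk⇔ fsuc-injective (cong fsuc)) (fsuc i ≟ fsuc j) (i ≟ j)) (sym (isYes≗does (i ≟ j))))

∑-δ : ∀ n (i : Fin n) (f : Fin n → ℕ) → ∑[ j ∈ allFin n ] (𝟙 (i == j) * f j) ≡ f i
∑-δ (suc n) fzero f = begin
  ∑[ j ∈ allFin (suc n) ] (𝟙 (fzero == j) * f j)
    ≡⟨ ∑-allFin-suc n (λ j → 𝟙 (fzero == j) * f j) ⟩
  𝟙 (fzero {n} == fzero) * f fzero + ∑[ j ∈ allFin n ] (𝟙 (fzero == fsuc j) * f (fsuc j))
    ≡⟨ cong₂ _+_ (cong (λ b → 𝟙 b * f fzero) (==-refl {suc n} fzero))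
                 (∑-zero (allFin n) _ (λ j → cong (λ b → 𝟙 b * f (fsuc j)) (==-≢ {i = fzero} {fsuc j} λ ()))) ⟩
  1 * f fzero + 0
    ≡⟨ trans (+-identityʳ _) (*-identityˡ _) ⟩
  f fzero ∎
  where open ≡-Reasoning
∑-δ (suc n) (fsuc i) f = begin
  ∑[ j ∈ allFin (suc n) ] (𝟙 (fsuc i == j) * f j)
    ≡⟨ ∑-allFin-suc n (λ j → 𝟙 (fsuc i == j) * f j) ⟩
  𝟙 (fsuc i == fzero) * f fzero + ∑[ j ∈ allFin n ] (𝟙 (fsuc i == fsuc j) * f (fsuc j))
    ≡⟨ cong₂ _+_ (cong (λ b → 𝟙 b * f fzero) (==-≢ {i = fsuc i} {fzero} λ ()))
                 (∑-cong (allFin n) (λ j → cong (λ b → 𝟙 b * f (fsuc j)) (==-suc i j))) ⟩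
  0 + ∑[ j ∈ allFin n ] (𝟙 (i == j) * f (fsuc j))
    ≡⟨ ∑-δ n i (f ∘ fsuc) ⟩
  f (fsuc i) ∎
  where open ≡-Reasoning

∑-δ-count : ∀ n (i : Fin n) → ∑[ j ∈ allFin n ] 𝟙 (i == j) ≡ 1
∑-δ-count n i = trans (∑-cong (allFin n) (λ j → sym (*-identityʳ (𝟙 (i == j))))) (∑-δ n i (λ _ → 1))

∑-allFin-const : ∀ n k → ∑[ _ ∈ allFin n ] k ≡ n * k
∑-allFin-const n k = trans (∑-const (allFin n) k) (cong (_* k) (length-tabulate {n = n} (λ i → i)))

term-≤-∑ : ∀ n (f : Fin n → ℕ) (i : Fin n) → f i ≤ ∑ (allFin n) f
term-≤-∑ n f i = subst (_≤ ∑ (allFin n) f) (∑-δ n i f) (∑-mono (allFin n) (λ j → 𝟙-*-≤ (i == j) (f j)))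

twoTerms-≤-∑ : ∀ n (f : Fin n → ℕ) (i j : Fin n) → i ≢ j → f i + f j ≤ ∑ (allFin n) f
twoTerms-≤-∑ n f i j i≢j = subst (_≤ ∑ (allFin n) f) split (∑-mono (allFin n) atMostOnce)
  where
  atMostOnce : ∀ k → (𝟙 (i == k) + 𝟙 (j == k)) * f k ≤ f k
  atMostOnce k with i ≟ k | j ≟ k
  ... | yes refl | yes refl = ⊥-elim (i≢j refl)
  ... | yes _    | no _     = ≤-reflexive (+-identityʳ (f k))
  ... | no _     | yes _    = ≤-reflexive (+-identityʳ (f k))
  ... | no _     | no _     = z≤n
  split : ∑[ k ∈ allFin n ] ((𝟙 (i == k) + 𝟙 (j == k)) * f k) ≡ f i + f j
  split = trans (∑-cong (allFin n) (λ k → *-distribʳ-+ (f k) (𝟙 (i == k)) (𝟙 (j == k))))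
                (trans (∑-distrib-+ (allFin n) _ _) (cong₂ _+_ (∑-δ n i f) (∑-δ n j f)))

∑₂ : ∀ n → (Fin n → Fin n → ℕ) → ℕ
∑₂ n f = ∑[ i ∈ allFin n ] ∑[ j ∈ allFin n ] f i j

module _ (n : ℕ) where

  ∑₂-cong : {f g : Fin n → Fin n → ℕ} → (∀ i j → f i j ≡ g i j) → ∑₂ n f ≡ ∑₂ n g
  ∑₂-cong e = ∑-cong (allFin n) (λ i → ∑-cong (allFin n) (e i))

  ∑₂-mono : {f g : Fin n → Fin n → ℕ} → (∀ i j → f i j ≤ g i j) → ∑₂ n f ≤ ∑₂ n g
  ∑₂-mono e = ∑-mono (allFin n) (λ i → ∑-mono (allFin n) (e i))

  ∑₂-distrib-+ : ∀ (f g : Fin n → Fin n → ℕ) → ∑₂ n (λ i j → f i j + g i j) ≡ ∑₂ n f + ∑₂ n g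
  ∑₂-distrib-+ f g = trans (∑-cong (allFin n) (λ i → ∑-distrib-+ (allFin n) (f i) (g i))) (∑-distrib-+ (allFin n) _ _)

  ∑₂-*ʳ : ∀ (f : Fin n → Fin n → ℕ) k → ∑₂ n (λ i j → f i j * k) ≡ ∑₂ n f * k
  ∑₂-*ʳ f k = trans (∑-cong (allFin n) (λ i → ∑-*ʳ (allFin n) k (f i))) (∑-*ʳ (allFin n) k _)

  ∑₂-*ˡ : ∀ k (f : Fin n → Fin n → ℕ) → ∑₂ n (λ i j → k * f i j) ≡ k * ∑₂ n f
  ∑₂-*ˡ k f = trans (∑-cong (allFin n) (λ i → ∑-*ˡ (allFin n) k (f i))) (∑-*ˡ (allFin n) k _)

  ∑₂-square : ∀ (f : Fin n → Fin n → ℕ) → ∑₂ n f * ∑₂ n f ≡ ∑₂ n (λ i j → ∑₂ n (λ k l → f i j * f k l))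
  ∑₂-square f = trans (sym (∑₂-*ʳ f (∑₂ n f))) (∑₂-cong (λ i j → sym (∑₂-*ˡ (f i j) f)))

  ∑₂-flip : ∀ (f : Fin n → Fin n → ℕ) → ∑₂ n (λ i j → f j i) ≡ ∑₂ n f
  ∑₂-flip f = ∑-comm (allFin n) (allFin n) (λ i j → f j i)

  ∑₂-δ-count : ∀ (i j : Fin n) → ∑₂ n (λ k l → 𝟙 ((k == i) ∧ (l == j))) ≡ 1
  ∑₂-δ-count i j = begin
    ∑₂ n (λ k l → 𝟙 ((k == i) ∧ (l == j)))
      ≡⟨ ∑₂-cong (λ k l → trans (𝟙-∧ (k == i) (l == j)) (cong₂ (λ a b → 𝟙 a * 𝟙 b) (==-sym k i) (==-sym l j))) ⟩
    ∑[ k ∈ allFin n ] ∑[ l ∈ allFin n ] (𝟙 (i == k) * 𝟙 (j == l))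
      ≡⟨ ∑-cong (allFin n) (λ k → trans (∑-*ˡ (allFin n) (𝟙 (i == k)) (λ l → 𝟙 (j == l))) (cong (𝟙 (i == k) *_) (∑-δ-count n j))) ⟩
    ∑[ k ∈ allFin n ] (𝟙 (i == k) * 1)
      ≡⟨ ∑-δ n i (λ _ → 1) ⟩
    1 ∎
    where open ≡-Reasoning

  twoTerms-≤-∑₂ : ∀ (f : Fin n → Fin n → ℕ) (i j : Fin n) → i ≢ j → f i j + f j i ≤ ∑₂ n f
  twoTerms-≤-∑₂ f i j i≢j = ≤-trans (+-mono-≤ (term-≤-∑ n (f i) j) (term-≤-∑ n (f j) i))
                                    (twoTerms-≤-∑ n (λ k → ∑ (allFin n) (f k)) i j i≢j)

∑-∑₂-comm : ∀ {A : Set} (L : List A) n (f : A → Fin n → Fin n → ℕ) →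
  ∑[ a ∈ L ] ∑₂ n (f a) ≡ ∑₂ n (λ i j → ∑[ a ∈ L ] f a i j)
∑-∑₂-comm L n f = trans (∑-comm L (allFin n) _) (∑-cong (allFin n) (λ i → ∑-comm L (allFin n) _))

∑-allMaps-suc : ∀ x n (h : Vec (Fin x) (suc n) → ℕ) →
  ∑ (allMaps x (suc n)) h ≡ ∑[ k ∈ allFin x ] ∑[ c ∈ allMaps x n ] h (k ∷ c)
∑-allMaps-suc x n h = trans (∑-concatMap (allFin x) (λ k → map (k ∷_) (allMaps x n)) h)
                            (∑-cong (allFin x) (λ k → ∑-map (allMaps x n) (k ∷_) h))

count-allMaps : ∀ x n → ∑[ _ ∈ allMaps x n ] 1 ≡ x ^ n
count-allMaps x zero    = refl
count-allMaps x (suc n) = trans (∑-allMaps-suc x n (λ _ → 1))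
  (trans (∑-cong (allFin x) (λ _ → count-allMaps x n)) (∑-allFin-const x (x ^ n)))

∑-allMaps-insertAt : ∀ x n (p : Fin (suc n)) (h : Vec (Fin x) (suc n) → ℕ) →
  ∑ (allMaps x (suc n)) h ≡ ∑[ k ∈ allFin x ] ∑[ c ∈ allMaps x n ] h (insertAt c p k)
∑-allMaps-insertAt x n       fzero    h = ∑-allMaps-suc x n h
∑-allMaps-insertAt x (suc n) (fsuc p) h = begin
  ∑ (allMaps x (suc (suc n))) h
    ≡⟨ ∑-allMaps-suc x (suc n) h ⟩
  ∑[ k₀ ∈ allFin x ] ∑[ c ∈ allMaps x (suc n) ] h (k₀ ∷ c)
    ≡⟨ ∑-cong (allFin x) (λ k₀ → ∑-allMaps-insertAt x n p (λ c → h (k₀ ∷ c))) ⟩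
  ∑[ k₀ ∈ allFin x ] ∑[ k ∈ allFin x ] ∑[ c ∈ allMaps x n ] h (k₀ ∷ insertAt c p k)
    ≡⟨ ∑-comm (allFin x) (allFin x) _ ⟩
  ∑[ k ∈ allFin x ] ∑[ k₀ ∈ allFin x ] ∑[ c ∈ allMaps x n ] h (k₀ ∷ insertAt c p k)
    ≡⟨ ∑-cong (allFin x) (λ k → sym (∑-allMaps-suc x n (λ c → h (insertAt c (fsuc p) k)))) ⟩
  ∑[ k ∈ allFin x ] ∑[ c ∈ allMaps x (suc n) ] h (insertAt c (fsuc p) k) ∎
  where open ≡-Reasoning

lookup-insertAt-≢ : ∀ {A : Set} {n} (c : Vec A n) {p i : Fin (suc n)} (k : A) (p≢i : p ≢ i) →
  lookup (insertAt c p k) i ≡ lookup c (punchOut p≢i)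
lookup-insertAt-≢ c {p} k p≢i =
  trans (cong (lookup (insertAt c p k)) (sym (punchIn-punchOut p≢i))) (insertAt-punchIn c p k (punchOut p≢i))

count-agreeing : ∀ x n (a b : Fin (suc n)) → a ≢ b →
  ∑[ c ∈ allMaps x (suc n) ] 𝟙 (lookup c a == lookup c b) ≡ x ^ n
count-agreeing x n a b a≢b = begin
  ∑[ c ∈ allMaps x (suc n) ] 𝟙 (lookup c a == lookup c b)
    ≡⟨ ∑-allMaps-insertAt x n a _ ⟩
  ∑[ k ∈ allFin x ] ∑[ c ∈ allMaps x n ] 𝟙 (lookup (insertAt c a k) a == lookup (insertAt c a k) b)
    ≡⟨ ∑-cong (allFin x) (λ k → ∑-cong (allMaps x n) (λ c →
         cong 𝟙 (cong₂ _==_ (insertAt-lookup c a k) (lookup-insertAt-≢ c k a≢b)))) ⟩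
  ∑[ k ∈ allFin x ] ∑[ c ∈ allMaps x n ] 𝟙 (k == lookup c b′)
    ≡⟨ ∑-comm (allFin x) (allMaps x n) _ ⟩
  ∑[ c ∈ allMaps x n ] ∑[ k ∈ allFin x ] 𝟙 (k == lookup c b′)
    ≡⟨ ∑-cong (allMaps x n) (λ c → trans (∑-cong (allFin x) (λ k → cong 𝟙 (==-sym k (lookup c b′))))
                                          (∑-δ-count x (lookup c b′))) ⟩
  ∑[ _ ∈ allMaps x n ] 1
    ≡⟨ count-allMaps x n ⟩
  x ^ n ∎
  where
  open ≡-Reasoning
  b′ = punchOut a≢b

count-agreeing-twice : ∀ x n (a b d e : Fin (suc (suc n))) → b ≢ a → b ≢ d → b ≢ e → d ≢ e →
  ∑[ c ∈ allMaps x (suc (suc n)) ] (𝟙 (lookup c a == lookup c b) * 𝟙 (lookup c d == lookup c e)) ≡ x ^ n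
count-agreeing-twice x n a b d e b≢a b≢d b≢e d≢e = begin
  ∑[ c ∈ allMaps x (suc (suc n)) ] (𝟙 (lookup c a == lookup c b) * 𝟙 (lookup c d == lookup c e))
    ≡⟨ ∑-allMaps-insertAt x (suc n) b _ ⟩
  ∑[ k ∈ allFin x ] ∑[ c ∈ allMaps x (suc n) ] (𝟙 (c⁺ c k a == c⁺ c k b) * 𝟙 (c⁺ c k d == c⁺ c k e))
    ≡⟨ ∑-cong (allFin x) (λ k → ∑-cong (allMaps x (suc n)) (λ c → cong₂ _*_
         (cong 𝟙 (cong₂ _==_ (lookup-insertAt-≢ c k b≢a) (insertAt-lookup c b k)))
         (cong 𝟙 (cong₂ _==_ (lookup-insertAt-≢ c k b≢d) (lookup-insertAt-≢ c k b≢e))))) ⟩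
  ∑[ k ∈ allFin x ] ∑[ c ∈ allMaps x (suc n) ] (𝟙 (lookup c a′ == k) * 𝟙 (lookup c d′ == lookup c e′))
    ≡⟨ ∑-comm (allFin x) (allMaps x (suc n)) _ ⟩
  ∑[ c ∈ allMaps x (suc n) ] ∑[ k ∈ allFin x ] (𝟙 (lookup c a′ == k) * 𝟙 (lookup c d′ == lookup c e′))
    ≡⟨ ∑-cong (allMaps x (suc n)) (λ c → ∑-δ x (lookup c a′) (λ _ → 𝟙 (lookup c d′ == lookup c e′))) ⟩
  ∑[ c ∈ allMaps x (suc n) ] 𝟙 (lookup c d′ == lookup c e′)
    ≡⟨ count-agreeing x n d′ e′ (λ d′≡e′ → d≢e (punchOut-injective b≢d b≢e d′≡e′)) ⟩
  x ^ n ∎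
  where
  open ≡-Reasoning
  c⁺ : Vec (Fin x) (suc n) → Fin x → Fin (suc (suc n)) → Fin x
  c⁺ c k = lookup (insertAt c b k)
  a′ = punchOut b≢a
  d′ = punchOut b≢d
  e′ = punchOut b≢e

toℕ<⇒≢ : ∀ {N} {a b : Fin N} → toℕ a < toℕ b → a ≢ b
toℕ<⇒≢ a<b refl = <-irrefl refl a<b

distinctEdges-endpoint : ∀ {N} {i j k l : Fin N} → toℕ i < toℕ j → toℕ k < toℕ l →
  ¬ (k ≡ i × l ≡ j) → (j ≢ k × j ≢ l) ⊎ (i ≢ k × i ≢ l)
distinctEdges-endpoint {i = i} {j} {k} {l} i<j k<l ≢ij with j ≟ k | j ≟ l | i ≟ k | i ≟ l
... | no j≢k   | no j≢l   | _        | _        = inj₁ (j≢k , j≢l)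
... | _        | _        | no i≢k   | no i≢l   = inj₂ (i≢k , i≢l)
... | yes refl | _        | yes refl | _        = ⊥-elim (<-irrefl refl i<j)
... | yes refl | _        | no _     | yes refl = ⊥-elim (<-asym i<j k<l)
... | no _     | yes refl | yes refl | _        = ⊥-elim (≢ij (refl , refl))
... | no _     | yes refl | no _     | yes refl = ⊥-elim (<-irrefl refl i<j)

module _ (x m : ℕ) {i j k l : Fin (suc (suc m))} (i<j : toℕ i < toℕ j) (k<l : toℕ k < toℕ l) where

  count-agreeing-on-distinctEdges : ¬ (k ≡ i × l ≡ j) →
    ∑[ c ∈ allMaps x (suc (suc m)) ] (𝟙 (lookup c i == lookup c j) * 𝟙 (lookup c k == lookup c l)) ≡ x ^ m
  count-agreeing-on-distinctEdges ≢ij with distinctEdges-endpoint i<j k<l ≢ij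
  ... | inj₁ (j≢k , j≢l) = count-agreeing-twice x m i j k l (toℕ<⇒≢ i<j ∘ sym) j≢k j≢l (toℕ<⇒≢ k<l)
  ... | inj₂ (i≢k , i≢l) =
    trans (∑-cong (allMaps x (suc (suc m)))
                  (λ c → cong (λ b → 𝟙 b * 𝟙 (lookup c k == lookup c l)) (==-sym (lookup c i) (lookup c j))))
          (count-agreeing-twice x m j i k l (toℕ<⇒≢ i<j) i≢k i≢l (toℕ<⇒≢ k<l))

  count-agreeing-on-edges :
    ∑[ c ∈ allMaps x (suc (suc m)) ] (𝟙 (lookup c i == lookup c j) * 𝟙 (lookup c k == lookup c l))
      ≤ x ^ m + 𝟙 ((k == i) ∧ (l == j)) * x ^ suc m
  count-agreeing-on-edges with k ≟ i | l ≟ j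
  ... | yes refl | yes refl = ≤-trans (≤-reflexive sameEdge) (m≤n+m (1 * x ^ suc m) (x ^ m))
    where
    sameEdge : ∑[ c ∈ allMaps x (suc (suc m)) ] (𝟙 (lookup c i == lookup c j) * 𝟙 (lookup c i == lookup c j))
               ≡ 1 * x ^ suc m
    sameEdge = trans (∑-cong (allMaps x (suc (suc m))) (λ c → 𝟙-idem (lookup c i == lookup c j)))
                     (trans (count-agreeing x (suc m) i j (toℕ<⇒≢ i<j)) (sym (*-identityˡ _)))
  ... | yes refl | no l≢j = ≤-trans (≤-reflexive (count-agreeing-on-distinctEdges (λ (_ , l≡j) → l≢j l≡j))) (m≤m+n _ _)
  ... | no k≢i   | _      = ≤-trans (≤-reflexive (count-agreeing-on-distinctEdges (λ (k≡i , _) → k≢i k≡i))) (m≤m+n _ _)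

∈-upTo : ∀ {k n} → k < n → k ∈ upTo n
∈-upTo {k} {suc n} (s≤s k≤n) with m≤n⇒m<n∨m≡n k≤n
... | inj₁ k<n  = ∈-++⁺ˡ (∈-upTo k<n)
... | inj₂ refl = ∈-++⁺ʳ (upTo n) (here refl)

∈-upTo⁻ : ∀ {k n} → k ∈ upTo n → k < n
∈-upTo⁻ {k} {suc n} k∈ with ∈-++⁻ (upTo n) k∈
... | inj₁ k∈′        = m<n⇒m<1+n (∈-upTo⁻ k∈′)
... | inj₂ (here refl) = ≤-refl

⟨$⟩ʳ-injective : ∀ {n} (σ : Perm n) {a b} → σ ⟨$⟩ʳ a ≡ σ ⟨$⟩ʳ b → a ≡ b
⟨$⟩ʳ-injective σ e = trans (sym (inverseˡ σ)) (trans (cong (σ ⟨$⟩ˡ_) e) (inverseˡ σ))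

module _ {n : ℕ} (σ : Perm n) where

  iter-+ : ∀ k d a → iter σ (k + d) a ≡ iter σ k (iter σ d a)
  iter-+ zero    d a = refl
  iter-+ (suc k) d a = cong (σ ⟨$⟩ʳ_) (iter-+ k d a)

  iter-comm : ∀ k d a → iter σ k (iter σ d a) ≡ iter σ d (iter σ k a)
  iter-comm k d a = trans (sym (iter-+ k d a)) (trans (cong (λ e → iter σ e a) (+-comm k d)) (iter-+ d k a))

  iter-injective : ∀ k {a b} → iter σ k a ≡ iter σ k b → a ≡ b
  iter-injective zero    e = e
  iter-injective (suc k) e = iter-injective k (⟨$⟩ʳ-injective σ e)

  -- Two of the n + 1 points a, σ a, …, σⁿ a coincide.
  period : ∀ a → ∃ λ p → 0 < p × p ≤ n × iter σ p a ≡ a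
  period a with pigeonhole (n<1+n n) (λ (s : Fin (suc n)) → iter σ (toℕ s) a)
  ... | s , t , s<t , eq = p , m<n⇒0<n∸m s<t , p≤n , sym (iter-injective (toℕ s) eq′)
    where
    p = toℕ t ∸ toℕ s
    p≤n : p ≤ n
    p≤n = ≤-trans (m∸n≤m (toℕ t) (toℕ s)) (≤-pred (toℕ<n t))
    eq′ : iter σ (toℕ s) a ≡ iter σ (toℕ s) (iter σ p a)
    eq′ = trans eq (trans (cong (λ e → iter σ e a) (trans (sym (m∸n+n≡m (<⇒≤ s<t))) (+-comm p (toℕ s))))
                          (iter-+ (toℕ s) p a))

  iter-multiple : ∀ {p a} → iter σ p a ≡ a → ∀ q → iter σ (q * p) a ≡ a
  iter-multiple e zero    = refl
  iter-multiple {p} {a} e (suc q) = trans (iter-+ p (q * p) a) (trans (cong (iter σ p) (iter-multiple e q)) e)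

  iter-% : ∀ {p a} .{{_ : NonZero p}} → iter σ p a ≡ a → ∀ m → iter σ m a ≡ iter σ (m % p) a
  iter-% {p} {a} e m = trans (cong (λ z → iter σ z a) (m≡m%n+[m/n]*n m p))
                             (trans (iter-+ (m % p) ((m / p) * p) a) (cong (iter σ (m % p)) (iter-multiple e (m / p))))

  sameCycle⁺ : ∀ {i j} k → k < n → iter σ k i ≡ j → T (sameCycle σ i j)
  sameCycle⁺ {i} {j} k k<n e = any⁺ (λ k → iter σ k i == j) (lose (∈-upTo k<n) (fromWitness e))

  sameCycle⁻ : ∀ {i j} → T (sameCycle σ i j) → ∃ λ k → k < n × iter σ k i ≡ j
  sameCycle⁻ {i} {j} s with find (any⁻ (λ k → iter σ k i == j) (upTo n) s)
  ... | k , k∈ , e = k , ∈-upTo⁻ k∈ , toWitness e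

  -- If j = σᵏ i and σᵖ i = i, then i = σᵗ j with t = ((p - 1) k) mod p.
  sameCycle-sym : ∀ {i j} → T (sameCycle σ i j) → T (sameCycle σ j i)
  sameCycle-sym {i} {j} s with sameCycle⁻ s | period i
  ... | k , _ , refl | suc p′ , _ , p≤n , σᵖi≡i = sameCycle⁺ t (<-≤-trans (m%n<n (p′ * k) p) p≤n) (begin
    iter σ t (iter σ k i)          ≡⟨ iter-% σᵖj≡j (p′ * k) ⟨
    iter σ (p′ * k) (iter σ k i)   ≡⟨ iter-+ (p′ * k) k i ⟨
    iter σ (p′ * k + k) i          ≡⟨ cong (λ e → iter σ e i) (trans (+-comm (p′ * k) k) (*-comm p k)) ⟩
    iter σ (k * p) i               ≡⟨ iter-multiple σᵖi≡i k ⟩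
    i                              ∎)
    where
    open ≡-Reasoning
    p = suc p′
    t = (p′ * k) % p
    σᵖj≡j : iter σ p (iter σ k i) ≡ iter σ k i
    σᵖj≡j = trans (iter-comm p k i) (cong (iter σ k) σᵖi≡i)

  isCycleRep⁻ : ∀ {i} → T (isCycleRep σ i) → ∀ j → T (sameCycle σ i j) → toℕ i ≤ toℕ j
  isCycleRep⁻ {i} r j s = ≤ᵇ⇒≤ (toℕ i) (toℕ j) (Equivalence.to T-not-∨ (All.lookup (all⁺ _ (allFin n) r) (∈-allFin j)) s)

  isCycleRep⁺ : ∀ {i} → (∀ j → T (sameCycle σ i j) → toℕ i ≤ toℕ j) → T (isCycleRep σ i)
  isCycleRep⁺ {i} h = all⁻ _ (tabulate⁺ (λ j → Equivalence.from T-not-∨ (λ s → ≤⇒≤ᵇ (h j s))))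

  ¬isCycleRep : ∀ {y z} → T (sameCycle σ y z) → toℕ z < toℕ y → ¬ T (isCycleRep σ y)
  ¬isCycleRep {z = z} s z<y r = <⇒≱ z<y (isCycleRep⁻ r z s)

  numCycles≡∑ : numCycles σ ≡ ∑[ i ∈ allFin n ] 𝟙 (isCycleRep σ i)
  numCycles≡∑ = length-filter (isCycleRep σ) (allFin n)

  numCycles-id : (∀ i → σ ⟨$⟩ʳ i ≡ i) → numCycles σ ≡ n
  numCycles-id σ≗id = trans numCycles≡∑
    (trans (∑-cong (allFin n) (λ i → 𝟙-T (isCycleRep⁺ (λ j s → ≤-reflexive (cong toℕ (fixed s))))))
           (trans (∑-allFin-const n 1) (*-identityʳ n)))
    where
    iter-id : ∀ k i → iter σ k i ≡ i
    iter-id zero    i = refl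
    iter-id (suc k) i = trans (σ≗id _) (iter-id k i)
    fixed : ∀ {i j} → T (sameCycle σ i j) → i ≡ j
    fixed s with sameCycle⁻ s
    ... | k , _ , e = trans (sym (iter-id k _)) e

  numCycles-+-∑ : (f : Fin n → ℕ) → (∀ i → 𝟙 (isCycleRep σ i) + f i ≤ 1) → numCycles σ + ∑ (allFin n) f ≤ n
  numCycles-+-∑ f h = subst₂ _≤_ (trans (∑-distrib-+ (allFin n) _ f) (cong (_+ ∑ (allFin n) f) (sym numCycles≡∑)))
                                 (trans (∑-allFin-const n 1) (*-identityʳ n))
                                 (∑-mono (allFin n) h)

  numCycles-+1 : ∀ {y} → ¬ T (isCycleRep σ y) → numCycles σ + 1 ≤ n
  numCycles-+1 {y} ¬ry = subst (λ k → numCycles σ + k ≤ n) (∑-δ-count n y) (numCycles-+-∑ _ atMostOne)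
    where
    atMostOne : ∀ i → 𝟙 (isCycleRep σ i) + 𝟙 (y == i) ≤ 1
    atMostOne i with y ≟ i
    ... | yes refl = ≤-reflexive (cong (_+ 1) (𝟙-¬T ¬ry))
    ... | no _     = ≤-trans (≤-reflexive (+-identityʳ _)) (𝟙≤1 _)

  numCycles-+2 : ∀ {y y′} → y ≢ y′ → ¬ T (isCycleRep σ y) → ¬ T (isCycleRep σ y′) → numCycles σ + 2 ≤ n
  numCycles-+2 {y} {y′} y≢y′ ¬ry ¬ry′ =
    subst (λ k → numCycles σ + k ≤ n) two (numCycles-+-∑ _ atMostOne)
    where
    two : ∑[ i ∈ allFin n ] (𝟙 (y == i) + 𝟙 (y′ == i)) ≡ 2
    two = trans (∑-distrib-+ (allFin n) _ _) (cong₂ _+_ (∑-δ-count n y) (∑-δ-count n y′))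
    atMostOne : ∀ i → 𝟙 (isCycleRep σ i) + (𝟙 (y == i) + 𝟙 (y′ == i)) ≤ 1
    atMostOne i with y ≟ i | y′ ≟ i
    ... | yes refl | yes refl = ⊥-elim (y≢y′ refl)
    ... | yes refl | no _     = ≤-reflexive (cong (_+ 1) (𝟙-¬T ¬ry))
    ... | no _     | yes refl = ≤-reflexive (cong (_+ 1) (𝟙-¬T ¬ry′))
    ... | no _     | no _     = ≤-trans (≤-reflexive (+-identityʳ _)) (𝟙≤1 _)

  nonRep-of-pair : ∀ {a b} → a ≢ b → T (sameCycle σ a b) → ∃ λ y → (y ≡ a ⊎ y ≡ b) × ¬ T (isCycleRep σ y)
  nonRep-of-pair {a} {b} a≢b s with <-cmp (toℕ a) (toℕ b)
  ... | tri< a<b _ _ = b , inj₂ refl , ¬isCycleRep (sameCycle-sym s) a<b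
  ... | tri≈ _ a≡b _ = ⊥-elim (a≢b (toℕ-injective a≡b))
  ... | tri> _ _ b<a = a , inj₁ refl , ¬isCycleRep s b<a

  numCycles-+1-of-pair : ∀ {a b} → a ≢ b → T (sameCycle σ a b) → numCycles σ + 1 ≤ n
  numCycles-+1-of-pair a≢b s with nonRep-of-pair a≢b s
  ... | _ , _ , ¬r = numCycles-+1 ¬r

  numCycles-+2-of-pairs : ∀ {a b d e} → a ≢ b → T (sameCycle σ a b) → d ≢ e → T (sameCycle σ d e) →
    a ≢ d → a ≢ e → b ≢ d → b ≢ e → numCycles σ + 2 ≤ n
  numCycles-+2-of-pairs a≢b sab d≢e sde a≢d a≢e b≢d b≢e
    with nonRep-of-pair a≢b sab | nonRep-of-pair d≢e sde
  ... | y , inj₁ refl , ¬r | y′ , inj₁ refl , ¬r′ = numCycles-+2 a≢d ¬r ¬r′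
  ... | y , inj₁ refl , ¬r | y′ , inj₂ refl , ¬r′ = numCycles-+2 a≢e ¬r ¬r′
  ... | y , inj₂ refl , ¬r | y′ , inj₁ refl , ¬r′ = numCycles-+2 b≢d ¬r ¬r′
  ... | y , inj₂ refl , ¬r | y′ , inj₂ refl , ¬r′ = numCycles-+2 b≢e ¬r ¬r′

  numCycles-+2-of-triple : ∀ {a b c} → a ≢ b → b ≢ c → a ≢ c →
    T (sameCycle σ a b) → T (sameCycle σ a c) → T (sameCycle σ b c) → numCycles σ + 2 ≤ n
  numCycles-+2-of-triple {a} {b} {c} a≢b b≢c a≢c sab sac sbc
    with <-cmp (toℕ a) (toℕ b) | <-cmp (toℕ a) (toℕ c) | <-cmp (toℕ b) (toℕ c)
  ... | tri≈ _ e _ | _ | _ = ⊥-elim (a≢b (toℕ-injective e))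
  ... | _ | tri≈ _ e _ | _ = ⊥-elim (a≢c (toℕ-injective e))
  ... | _ | _ | tri≈ _ e _ = ⊥-elim (b≢c (toℕ-injective e))
  ... | tri< a<b _ _ | tri< a<c _ _ | _ =
    numCycles-+2 b≢c (¬isCycleRep (sameCycle-sym sab) a<b) (¬isCycleRep (sameCycle-sym sac) a<c)
  ... | tri< a<b _ _ | tri> _ _ c<a | _ =
    numCycles-+2 a≢b (¬isCycleRep sac c<a) (¬isCycleRep sbc (<-trans c<a a<b))
  ... | tri> _ _ b<a | _ | tri< b<c _ _ =
    numCycles-+2 a≢c (¬isCycleRep sab b<a) (¬isCycleRep (sameCycle-sym sbc) b<c)
  ... | tri> _ _ b<a | _ | tri> _ _ c<b =
    numCycles-+2 a≢b (¬isCycleRep sac (<-trans c<b b<a)) (¬isCycleRep sbc c<b)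

  sameCycle-refl : ∀ i → T (sameCycle σ i i)
  sameCycle-refl i = sameCycle⁺ 0 (≤-trans (s≤s z≤n) (toℕ<n i)) refl

  sameCycle-step : 1 < n → ∀ i → T (sameCycle σ i (σ ⟨$⟩ʳ i))
  sameCycle-step 1<n i = sameCycle⁺ 1 1<n refl

module _ {n x : ℕ} (Γ : Graph n) (σ : Perm n) {c : Vec (Fin x) n} (proper : T (properQuot Γ σ c)) where

  proper-invariant : ∀ i → T (lookup c (σ ⟨$⟩ʳ i) == lookup c i)
  proper-invariant i = All.lookup (all⁺ _ (allFin n) (proj₁ (Equivalence.to T-∧ proper))) (∈-allFin i)

  proper-separates : ∀ u v → T (quotAdj Γ σ u v) → ¬ T (lookup c u == lookup c v)
  proper-separates u v q = T-not⇒¬T (Equivalence.to T-not-∨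
    (All.lookup (all⁺ _ (allFin n) (All.lookup (all⁺ _ (allFin n) (proj₂ (Equivalence.to T-∧ proper))) (∈-allFin u)))
                (∈-allFin v)) q)

quotAdj⁺ : ∀ {n} (Γ : Graph n) (σ : Perm n) {u v u′ v′} →
  T (sameCycle σ u u′) → T (sameCycle σ v v′) → T (adj Γ u′ v′) → T (quotAdj Γ σ u v)
quotAdj⁺ Γ σ {u′ = u′} {v′} su sv a =
  any⁺ _ (lose (∈-allFin u′) (any⁺ _ (lose (∈-allFin v′) (Equivalence.from T-∧ (su , Equivalence.from T-∧ (sv , a))))))

module _ {n x : ℕ} (Γ : Graph n) (σ : Perm n) where

  proper-edge : ∀ {c : Vec (Fin x) n} → T (properQuot Γ σ c) → ∀ {u v} → T (adj Γ u v) → ¬ T (lookup c u == lookup c v)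
  proper-edge {c} p {u} {v} a = proper-separates Γ σ {c} p u v (quotAdj⁺ Γ σ (sameCycle-refl σ u) (sameCycle-refl σ v) a)

  ¬proper-loop : 1 < n → ∀ {i} → T (adj Γ i (σ ⟨$⟩ʳ i)) → ∀ (c : Vec (Fin x) n) → ¬ T (properQuot Γ σ c)
  ¬proper-loop 1<n {i} a c p =
    proper-separates Γ σ {c} p i i (quotAdj⁺ Γ σ (sameCycle-refl σ i) (sameCycle-step σ 1<n i) a) (fromWitness refl)

  chromQuot≡∑ : chromQuot Γ σ x ≡ ∑[ c ∈ allMaps x n ] 𝟙 (properQuot Γ σ c)
  chromQuot≡∑ = length-filter (properQuot Γ σ) (allMaps x n)

  chromQuot-loop : 1 < n → ∀ {i} → T (adj Γ i (σ ⟨$⟩ʳ i)) → chromQuot Γ σ x ≡ 0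
  chromQuot-loop 1<n a = trans chromQuot≡∑ (∑-zero (allMaps x n) _ (λ c → 𝟙-¬T (¬proper-loop 1<n a c)))

chromQuot-moved : ∀ {m x} (Γ : Graph (suc m)) (σ : Perm (suc m)) {i} → σ ⟨$⟩ʳ i ≢ i → chromQuot Γ σ x ≤ x ^ m
chromQuot-moved {m} {x} Γ σ {i} σi≢i =
  subst₂ _≤_ (sym (chromQuot≡∑ {x = x} Γ σ)) (count-agreeing x m (σ ⟨$⟩ʳ i) i σi≢i)
         (∑-mono (allMaps x (suc m)) (λ c → 𝟙-mono {properQuot Γ σ c} (λ p → proper-invariant Γ σ {c} p i)))

chromQuot-twoMoved : ∀ {m x} (Γ : Graph (suc (suc m))) (σ : Perm (suc (suc m))) {i k} →
  i ≢ σ ⟨$⟩ʳ i → i ≢ σ ⟨$⟩ʳ k → i ≢ k → σ ⟨$⟩ʳ k ≢ k → chromQuot Γ σ x ≤ x ^ m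
chromQuot-twoMoved {m} {x} Γ σ {i} {k} i≢σi i≢σk i≢k σk≢k =
  subst₂ _≤_ (sym (chromQuot≡∑ {x = x} Γ σ)) (count-agreeing-twice x m (σ ⟨$⟩ʳ i) i (σ ⟨$⟩ʳ k) k i≢σi i≢σk i≢k σk≢k)
         (∑-mono (allMaps x (suc (suc m))) (λ c → ≤-trans
           (𝟙-mono {properQuot Γ σ c} (λ p → Equivalence.from T-∧ (proper-invariant Γ σ {c} p i , proper-invariant Γ σ {c} p k)))
           (≤-reflexive (𝟙-∧ (lookup c (σ ⟨$⟩ʳ i) == lookup c i) (lookup c (σ ⟨$⟩ʳ k) == lookup c k)))))

isEdge< : ∀ {n} → Graph n → Fin n → Fin n → Bool
isEdge< Γ i j = (toℕ i <ᵇ toℕ j) ∧ adj Γ i j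

module _ {n : ℕ} (Γ : Graph n) where

  numEdges≡∑₂ : numEdges Γ ≡ ∑₂ n (λ i j → 𝟙 (isEdge< Γ i j))
  numEdges≡∑₂ = trans (length-filter (λ b → b) rows)
    (trans (∑-concatMap (allFin n) row 𝟙) (∑-cong (allFin n) (λ i → ∑-map (allFin n) (isEdge< Γ i) 𝟙)))
    where
    row = λ i → map (isEdge< Γ i) (allFin n)
    rows = concatMap row (allFin n)

  isEdge<⇒< : ∀ {i j} → T (isEdge< Γ i j) → toℕ i < toℕ j
  isEdge<⇒< {i} {j} e = <ᵇ⇒< (toℕ i) (toℕ j) (proj₁ (Equivalence.to T-∧ e))

  isEdge<⇒adj : ∀ {i j} → T (isEdge< Γ i j) → T (adj Γ i j)
  isEdge<⇒adj {i} {j} e = proj₂ (Equivalence.to (T-∧ {toℕ i <ᵇ toℕ j}) e)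

s+s≤1+s*s : ∀ s → s + s ≤ 1 + s * s
s+s≤1+s*s zero    = z≤n
s+s≤1+s*s (suc s) = s≤s (begin
  s + suc s       ≡⟨ +-suc s s ⟩
  suc (s + s)     ≤⟨ s≤s (+-monoʳ-≤ s (≤-trans (m≤m+n s (s * s)) (≤-reflexive (sym (*-suc s s))))) ⟩
  suc (s + s * suc s) ∎)
  where open ≤-Reasoning

-- Bonferroni's inequality [s = 0] + 2 s ≤ 1 + s² for the number s of monochromatic edges of a
-- colouring; the sums of s and s² over all colourings are then counted edge by edge.
module Bonferroni {m : ℕ} (Γ : Graph (suc (suc m))) (σ : Perm (suc (suc m))) (x : ℕ) where

  private
    n = suc (suc m)
    M = numEdges Γ
    X₁ = x ^ suc m
    X₀ = x ^ m
    Colouring = Vec (Fin x) n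
    edge = λ i j → 𝟙 (isEdge< Γ i j)

  monochromatic : Colouring → Fin n → Fin n → ℕ
  monochromatic c i j = 𝟙 (isEdge< Γ i j) * 𝟙 (lookup c i == lookup c j)

  #monochromatic : Colouring → ℕ
  #monochromatic c = ∑₂ n (monochromatic c)

  proper⇒#monochromatic≡0 : ∀ {c} → T (properQuot Γ σ c) → #monochromatic c ≡ 0
  proper⇒#monochromatic≡0 {c} p = ∑-zero (allFin n) _ (λ i → ∑-zero (allFin n) _ (term i))
    where
    term : ∀ i j → monochromatic c i j ≡ 0
    term i j with isEdge< Γ i j in e
    ... | false = refl
    ... | true  = trans (+-identityʳ _) (𝟙-¬T (proper-edge Γ σ {c} p (isEdge<⇒adj Γ {i} {j} (subst T (sym e) _))))

  proper+2#monochromatic≤1+#monochromatic² : ∀ c →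
    𝟙 (properQuot Γ σ c) + (#monochromatic c + #monochromatic c) ≤ 1 + #monochromatic c * #monochromatic c
  proper+2#monochromatic≤1+#monochromatic² c with T? (properQuot Γ σ c)
  ... | yes p = subst (λ s → 𝟙 (properQuot Γ σ c) + (s + s) ≤ 1 + s * s) (sym (proper⇒#monochromatic≡0 {c} p))
                      (≤-trans (≤-reflexive (+-identityʳ _)) (𝟙≤1 _))
  ... | no ¬p rewrite 𝟙-¬T ¬p = s+s≤1+s*s (#monochromatic c)

  ∑-monochromatic : ∀ i j → ∑[ c ∈ allMaps x n ] monochromatic c i j ≡ edge i j * X₁
  ∑-monochromatic i j with isEdge< Γ i j in e
  ... | false = ∑-zero (allMaps x n) _ (λ _ → refl)
  ... | true  = trans (∑-*ˡ (allMaps x n) 1 _)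
                      (cong (1 *_) (count-agreeing x (suc m) i j (toℕ<⇒≢ (isEdge<⇒< Γ (subst T (sym e) _)))))

  ∑-monochromatic² : ∀ i j k l → ∑[ c ∈ allMaps x n ] (monochromatic c i j * monochromatic c k l)
                                   ≤ edge i j * (edge k l * X₀ + 𝟙 ((k == i) ∧ (l == j)) * X₁)
  ∑-monochromatic² i j k l with isEdge< Γ i j in eij | isEdge< Γ k l in ekl
  ... | false | _     = ≤-reflexive (∑-zero (allMaps x n) _ (λ _ → refl))
  ... | true  | false = ≤-trans (≤-reflexive (∑-zero (allMaps x n) _ (λ c → *-zeroʳ (1 * 𝟙 (lookup c i == lookup c j))))) z≤n
  ... | true  | true  = subst₂ _≤_
    (∑-cong (allMaps x n) (λ c → sym (cong₂ _*_ (*-identityˡ (𝟙 (lookup c i == lookup c j)))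
                                                (*-identityˡ (𝟙 (lookup c k == lookup c l))))))
    (sym (trans (*-identityˡ _) (cong (_+ 𝟙 ((k == i) ∧ (l == j)) * X₁) (*-identityˡ X₀))))
    (count-agreeing-on-edges x m (isEdge<⇒< Γ (subst T (sym eij) _)) (isEdge<⇒< Γ (subst T (sym ekl) _)))

  ∑-#monochromatic : ∑[ c ∈ allMaps x n ] #monochromatic c ≡ M * X₁
  ∑-#monochromatic = begin
    ∑[ c ∈ allMaps x n ] #monochromatic c   ≡⟨ ∑-∑₂-comm (allMaps x n) n monochromatic ⟩
    ∑₂ n (λ i j → ∑[ c ∈ allMaps x n ] monochromatic c i j)
                                            ≡⟨ ∑₂-cong n ∑-monochromatic ⟩
    ∑₂ n (λ i j → edge i j * X₁)            ≡⟨ ∑₂-*ʳ n edge X₁ ⟩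
    ∑₂ n edge * X₁                          ≡⟨ cong (_* X₁) (numEdges≡∑₂ Γ) ⟨
    M * X₁                                  ∎
    where open ≡-Reasoning

  ∑-#monochromatic² : ∑[ c ∈ allMaps x n ] (#monochromatic c * #monochromatic c) ≤ M * (M * X₀ + X₁)
  ∑-#monochromatic² = begin
    ∑[ c ∈ allMaps x n ] (#monochromatic c * #monochromatic c)
      ≡⟨ ∑-cong (allMaps x n) (λ c → ∑₂-square n (monochromatic c)) ⟩
    ∑[ c ∈ allMaps x n ] ∑₂ n (λ i j → ∑₂ n (λ k l → monochromatic c i j * monochromatic c k l))
      ≡⟨ trans (∑-∑₂-comm (allMaps x n) n _) (∑₂-cong n (λ i j → ∑-∑₂-comm (allMaps x n) n _)) ⟩
    ∑₂ n (λ i j → ∑₂ n (λ k l → ∑[ c ∈ allMaps x n ] (monochromatic c i j * monochromatic c k l)))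
      ≤⟨ ∑₂-mono n (λ i j → ∑₂-mono n (∑-monochromatic² i j)) ⟩
    ∑₂ n (λ i j → ∑₂ n (λ k l → edge i j * (edge k l * X₀ + 𝟙 ((k == i) ∧ (l == j)) * X₁)))
      ≡⟨ ∑₂-cong n (λ i j → trans (∑₂-*ˡ n (edge i j) (λ k l → edge k l * X₀ + 𝟙 ((k == i) ∧ (l == j)) * X₁)) (cong (edge i j *_) (row i j))) ⟩
    ∑₂ n (λ i j → edge i j * (M * X₀ + X₁))
      ≡⟨ trans (∑₂-*ʳ n edge (M * X₀ + X₁)) (cong (_* (M * X₀ + X₁)) (sym (numEdges≡∑₂ Γ))) ⟩
    M * (M * X₀ + X₁) ∎
    where
    open ≤-Reasoning
    row : ∀ i j → ∑₂ n (λ k l → edge k l * X₀ + 𝟙 ((k == i) ∧ (l == j)) * X₁) ≡ M * X₀ + X₁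
    row i j = trans (∑₂-distrib-+ n (λ k l → edge k l * X₀) (λ k l → 𝟙 ((k == i) ∧ (l == j)) * X₁)) (cong₂ _+_
      (trans (∑₂-*ʳ n edge X₀) (cong (_* X₀) (sym (numEdges≡∑₂ Γ))))
      (trans (∑₂-*ʳ n (λ k l → 𝟙 ((k == i) ∧ (l == j))) X₁) (trans (cong (_* X₁) (∑₂-δ-count n i j)) (*-identityˡ X₁))))

  bonferroni : chromQuot Γ σ x + M * X₁ ≤ x ^ n + M * M * X₀
  bonferroni = +-cancelʳ-≤ (M * X₁) _ _ (begin
    (chromQuot Γ σ x + M * X₁) + M * X₁
      ≡⟨ trans (+-assoc (chromQuot Γ σ x) (M * X₁) (M * X₁))
               (cong₂ _+_ (chromQuot≡∑ {x = x} Γ σ) (sym (cong₂ _+_ ∑-#monochromatic ∑-#monochromatic))) ⟩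
    ∑[ c ∈ allMaps x n ] 𝟙 (properQuot Γ σ c) + (∑[ c ∈ allMaps x n ] #monochromatic c + ∑[ c ∈ allMaps x n ] #monochromatic c)
      ≡⟨ trans (∑-distrib-+ (allMaps x n) (λ c → 𝟙 (properQuot Γ σ c)) _)
               (cong (_+_ (∑[ c ∈ allMaps x n ] 𝟙 (properQuot Γ σ c))) (∑-distrib-+ (allMaps x n) #monochromatic #monochromatic)) ⟨
    ∑[ c ∈ allMaps x n ] (𝟙 (properQuot Γ σ c) + (#monochromatic c + #monochromatic c))
      ≤⟨ ∑-mono (allMaps x n) proper+2#monochromatic≤1+#monochromatic² ⟩
    ∑[ c ∈ allMaps x n ] (1 + #monochromatic c * #monochromatic c)
      ≡⟨ ∑-distrib-+ (allMaps x n) _ _ ⟩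
    ∑[ _ ∈ allMaps x n ] 1 + ∑[ c ∈ allMaps x n ] (#monochromatic c * #monochromatic c)
      ≤⟨ +-mono-≤ (≤-reflexive (count-allMaps x n)) ∑-#monochromatic² ⟩
    x ^ n + M * (M * X₀ + X₁)
      ≡⟨ rearrange (x ^ n) M X₀ X₁ ⟩
    (x ^ n + M * M * X₀) + M * X₁ ∎)
    where
    open ≤-Reasoning
    rearrange : ∀ a b c d → a + b * (b * c + d) ≡ (a + b * b * c) + b * d
    rearrange = solve-∀

_≟ₚ_ : ∀ {n} (σ τ : Perm n) → Dec (σ ≈ₚ τ)
σ ≟ₚ τ = all? (λ i → σ ⟨$⟩ʳ i ≟ τ ⟨$⟩ʳ i)

isAut? : ∀ {n} (Γ : Graph n) (σ : Perm n) → Dec (IsAut Γ σ)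
isAut? Γ σ = all? (λ i → all? (λ j → adj Γ (σ ⟨$⟩ʳ i) (σ ⟨$⟩ʳ j) Bool.≟ adj Γ i j))

transpose-left : ∀ {n} (i j : Fin n) → transpose i j ⟨$⟩ʳ i ≡ j
transpose-left i j rewrite dec-true (i ≟ i) refl = refl


transpose-right : ∀ {n} (i j : Fin n) → transpose i j ⟨$⟩ʳ j ≡ i
transpose-right i j with j ≟ i
... | yes refl = refl
... | no j≢i rewrite dec-true (j ≟ j) refl = refl

transpose-other : ∀ {n} (i j : Fin n) {k} → k ≢ i → k ≢ j → transpose i j ⟨$⟩ʳ k ≡ k
transpose-other i j {k} k≢i k≢j rewrite dec-false (k ≟ i) k≢i | dec-false (k ≟ j) k≢j = refl

transpose-comm : ∀ {n} (i j : Fin n) → transpose i j ≈ₚ transpose j i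
transpose-comm i j k = byCases (k ≟ i) (k ≟ j)
  where
  byCases : Dec (k ≡ i) → Dec (k ≡ j) → transpose i j ⟨$⟩ʳ k ≡ transpose j i ⟨$⟩ʳ k
  byCases (yes refl) (yes refl) = refl
  byCases (yes refl) (no _)     = trans (transpose-left k j) (sym (transpose-right j k))
  byCases (no _)     (yes refl) = trans (transpose-right i k) (sym (transpose-left k i))
  byCases (no k≢i)   (no k≢j)   = trans (transpose-other i j k≢i k≢j) (sym (transpose-other j i k≢j k≢i))

distinct⇒1<n : ∀ {n} {a b : Fin n} → a ≢ b → 1 < n
distinct⇒1<n {suc zero}    {fzero} {fzero} a≢b = ⊥-elim (a≢b refl)
distinct⇒1<n {suc (suc n)} _                   = s≤s (s≤s z≤n)

distinct³⇒2<n : ∀ {n} {a b c : Fin n} → a ≢ b → b ≢ c → a ≢ c → 2 < n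
distinct³⇒2<n {suc (suc (suc n))} _ _ _ = s≤s (s≤s (s≤s z≤n))
distinct³⇒2<n {suc zero}       {fzero}      {fzero}                   a≢b _   _   = ⊥-elim (a≢b refl)
distinct³⇒2<n {suc (suc zero)} {fzero}      {fzero}                   a≢b _   _   = ⊥-elim (a≢b refl)
distinct³⇒2<n {suc (suc zero)} {fsuc fzero} {fsuc fzero}              a≢b _   _   = ⊥-elim (a≢b refl)
distinct³⇒2<n {suc (suc zero)} {fzero}      {fsuc fzero} {fzero}      _   _   a≢c = ⊥-elim (a≢c refl)
distinct³⇒2<n {suc (suc zero)} {fzero}      {fsuc fzero} {fsuc fzero} _   b≢c _   = ⊥-elim (b≢c refl)
distinct³⇒2<n {suc (suc zero)} {fsuc fzero} {fzero}      {fzero}      _   b≢c _   = ⊥-elim (b≢c refl)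
distinct³⇒2<n {suc (suc zero)} {fsuc fzero} {fzero}      {fsuc fzero} _   _   a≢c = ⊥-elim (a≢c refl)

-- The three kinds of permutations that contribute differently to the coefficient of xⁿ⁻¹.
data Shape {n : ℕ} (σ : Perm n) : Set where
  identity      : (∀ i → σ ⟨$⟩ʳ i ≡ i) → Shape σ
  transposition : ∀ i → σ ⟨$⟩ʳ i ≢ i → σ ≈ₚ transpose i (σ ⟨$⟩ʳ i) → numCycles σ + 1 ≤ n → Shape σ
  twoMoved      : ∀ i k → i ≢ σ ⟨$⟩ʳ i → i ≢ σ ⟨$⟩ʳ k → i ≢ k → σ ⟨$⟩ʳ k ≢ k → numCycles σ + 2 ≤ n → Shape σ

module _ {n : ℕ} (σ : Perm n) {i : Fin n} (σi≢i : σ ⟨$⟩ʳ i ≢ i) where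

  private
    j = σ ⟨$⟩ʳ i
    i≢j : i ≢ j
    i≢j = σi≢i ∘ sym
    1<n : 1 < n
    1<n = distinct⇒1<n σi≢i

  shape-threeCycle : σ ⟨$⟩ʳ j ≢ i → Shape σ
  shape-threeCycle σj≢i = twoMoved i j i≢j (σj≢i ∘ sym) i≢j σj≢j
    (numCycles-+2-of-triple σ i≢j j≢σj i≢σj (sameCycle-step σ 1<n i) (sameCycle⁺ σ 2 2<n refl) (sameCycle-step σ 1<n j))
    where
    σj≢j : σ ⟨$⟩ʳ j ≢ j
    σj≢j σj≡j = i≢j (⟨$⟩ʳ-injective σ (sym σj≡j))
    j≢σj = σj≢j ∘ sym
    i≢σj = σj≢i ∘ sym
    2<n : 2 < n
    2<n = distinct³⇒2<n i≢j j≢σj i≢σj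

  shape-transposition : σ ⟨$⟩ʳ j ≡ i → (∀ k → k ≢ i → k ≢ j → σ ⟨$⟩ʳ k ≡ k) → Shape σ
  shape-transposition σj≡i fixesRest = transposition i σi≢i pointwise
    (numCycles-+1-of-pair σ i≢j (sameCycle-step σ 1<n i))
    where
    pointwise : σ ≈ₚ transpose i j
    pointwise k = byCases (k ≟ i) (k ≟ j)
      where
      byCases : Dec (k ≡ i) → Dec (k ≡ j) → σ ⟨$⟩ʳ k ≡ transpose i j ⟨$⟩ʳ k
      byCases (yes refl) _          = sym (transpose-left i j)
      byCases (no _)     (yes refl) = trans σj≡i (sym (transpose-right i j))
      byCases (no k≢i)   (no k≢j)   = trans (fixesRest k k≢i k≢j) (sym (transpose-other i j k≢i k≢j))

  shape-twoTranspositions : σ ⟨$⟩ʳ j ≡ i → ∀ {k} → k ≢ i → k ≢ j → σ ⟨$⟩ʳ k ≢ k → Shape σ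
  shape-twoTranspositions σj≡i {k} k≢i k≢j σk≢k = twoMoved i k i≢j i≢σk (k≢i ∘ sym) σk≢k
    (numCycles-+2-of-pairs σ i≢j (sameCycle-step σ 1<n i) (σk≢k ∘ sym) (sameCycle-step σ 1<n k)
      (k≢i ∘ sym) i≢σk (k≢j ∘ sym) (λ j≡σk → k≢i (sym (⟨$⟩ʳ-injective σ j≡σk))))
    where
    i≢σk : i ≢ σ ⟨$⟩ʳ k
    i≢σk i≡σk = k≢j (⟨$⟩ʳ-injective σ (trans (sym i≡σk) (sym σj≡i)))

shape : ∀ {n} (σ : Perm n) → Shape σ
shape {n} σ with all? (λ i → σ ⟨$⟩ʳ i ≟ i)
... | yes fixesAll = identity fixesAll
... | no ¬fixesAll with ¬∀⟶∃¬ n _ (λ i → σ ⟨$⟩ʳ i ≟ i) ¬fixesAll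
... | i , σi≢i with σ ⟨$⟩ʳ (σ ⟨$⟩ʳ i) ≟ i
...   | no σ²i≢i = shape-threeCycle σ σi≢i σ²i≢i
...   | yes σ²i≡i with any? (λ k → ¬? (k ≟ i) ×-dec ¬? (k ≟ σ ⟨$⟩ʳ i) ×-dec ¬? (σ ⟨$⟩ʳ k ≟ k))
...     | yes (k , k≢i , k≢σi , σk≢k) = shape-twoTranspositions σ σi≢i σ²i≡i k≢i k≢σi σk≢k
...     | no ¬movedElsewhere = shape-transposition σ σi≢i σ²i≡i fixesRest
  where
  fixesRest : ∀ k → k ≢ i → k ≢ σ ⟨$⟩ʳ i → σ ⟨$⟩ʳ k ≡ k
  fixesRest k k≢i k≢σi with σ ⟨$⟩ʳ k ≟ k
  ... | yes σk≡k = σk≡k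
  ... | no σk≢k  = ⊥-elim (¬movedElsewhere (k , k≢i , k≢σi , σk≢k))

IsUniversal : ∀ {n} → Graph n → Fin n → Set
IsUniversal Γ v = ∀ k → k ≢ v → T (adj Γ v k)

universal? : ∀ {n} (Γ : Graph n) v → Dec (IsUniversal Γ v)
universal? Γ v = all? (λ k → ¬? (k ≟ v) →-dec T? (adj Γ v k))

module _ {n : ℕ} (Γ : Graph n) where

  ¬universal⇒nonNeighbour : ∀ {v} → ¬ IsUniversal Γ v → ∃ λ k → k ≢ v × ¬ T (adj Γ v k)
  ¬universal⇒nonNeighbour {v} ¬u with ¬∀⟶∃¬ n _ (λ k → ¬? (k ≟ v) →-dec T? (adj Γ v k)) ¬u
  ... | k , ¬imp with k ≟ v | T? (adj Γ v k)
  ...   | yes refl | _     = ⊥-elim (¬imp (λ k≢k → ⊥-elim (k≢k refl)))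
  ...   | no _     | yes a = ⊥-elim (¬imp (λ _ → a))
  ...   | no k≢v   | no ¬a = k , k≢v , ¬a

  IsAut-cong : ∀ {σ τ} → σ ≈ₚ τ → IsAut Γ σ → IsAut Γ τ
  IsAut-cong σ≈τ aut i j = trans (sym (cong₂ (adj Γ) (σ≈τ i) (σ≈τ j))) (aut i j)

  -- A non-neighbour k of j would become a non-neighbour of the universal vertex v.
  ¬IsAut-transpose-universal : ∀ {v j} → IsUniversal Γ v → ¬ IsUniversal Γ j → ¬ IsAut Γ (transpose v j)
  ¬IsAut-transpose-universal {v} {j} uv ¬uj aut with ¬universal⇒nonNeighbour ¬uj
  ... | k , k≢j , ¬ajk with j ≟ v
  ...   | yes refl = ¬uj uv
  ...   | no j≢v with k ≟ v
  ...     | yes refl = ¬ajk (subst T (adj-sym Γ k j) (uv j j≢v))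
  ...     | no k≢v   = ¬ajk (subst T (trans (sym (aut v k)) (cong₂ (adj Γ) (transpose-left v j) (transpose-other v j k≢v k≢j)))
                                    (uv k k≢v))

transpositionWeight : ∀ {n} → Graph n → Fin n → Fin n → ℕ
transpositionWeight Γ i j = 𝟙 (not (i == j)) * (1 + 𝟙 (not (adj Γ i j)))

autTranspositionWeight : ∀ {n} → Graph n → ℕ
autTranspositionWeight {n} Γ = ∑₂ n (λ i j → transpositionWeight Γ i j * 𝟙? (isAut? Γ (transpose i j)))

<ᵇ-true : ∀ {a b} → a < b → (a <ᵇ b) ≡ true
<ᵇ-true {a} {b} a<b with a <ᵇ b in eq
... | true  = refl
... | false = ⊥-elim (subst T eq (<⇒<ᵇ a<b))

<ᵇ-false : ∀ {a b} → ¬ a < b → (a <ᵇ b) ≡ false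
<ᵇ-false {a} {b} a≮b with a <ᵇ b in eq
... | false = refl
... | true  = ⊥-elim (a≮b (<ᵇ⇒< a b (subst T (sym eq) _)))

-- (u - 1)(d - 1) ≥ 0 when both are positive.
u+d≤1+N : ∀ u d N → 1 ≤ d → d ≤ N → u * d ≤ N → u + d ≤ suc N
u+d≤1+N zero    d       N _   d≤N _     = m≤n⇒m≤1+n d≤N
u+d≤1+N (suc u) (suc d) N _   _   ud≤N  = s≤s (begin
  u + suc d           ≡⟨ +-comm u (suc d) ⟩
  suc d + u           ≤⟨ +-monoʳ-≤ (suc d) (m≤m*n u (suc d)) ⟩
  suc d + u * suc d   ≤⟨ ud≤N ⟩
  N                   ∎)
  where open ≤-Reasoning

module PairCounts {n′ : ℕ} (Γ : Graph (suc n′)) where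

  private
    n = suc n′
    different : Fin n → Fin n → ℕ
    different i j = 𝟙 (not (i == j))
    nonAdjacent : Fin n → Fin n → ℕ
    nonAdjacent i j = 𝟙 (not (adj Γ i j))
    swappable : Fin n → Fin n → Bool
    swappable i j = ⌊ isAut? Γ (transpose i j) ⌋

  #adjacent #nonAdjacent #nonSwappable #universal #nonUniversal : ℕ
  #adjacent     = ∑₂ n (λ i j → 𝟙 (adj Γ i j))
  #nonAdjacent  = ∑₂ n (λ i j → different i j * nonAdjacent i j)
  #nonSwappable = ∑₂ n (λ i j → different i j * 𝟙 (not (swappable i j)))
  #universal    = ∑[ v ∈ allFin n ] 𝟙? (universal? Γ v)
  #nonUniversal = ∑[ v ∈ allFin n ] 𝟙 (not ⌊ universal? Γ v ⌋)

  twice-numEdges : 2 * numEdges Γ ≡ #adjacent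
  twice-numEdges = begin
    2 * numEdges Γ           ≡⟨ cong (2 *_) (numEdges≡∑₂ Γ) ⟩
    2 * ∑₂ n edge            ≡⟨ cong (_+_ (∑₂ n edge)) (trans (+-identityʳ _) (sym (∑₂-flip n edge))) ⟩
    ∑₂ n edge + ∑₂ n (λ i j → edge j i)
                             ≡⟨ ∑₂-distrib-+ n edge (λ i j → edge j i) ⟨
    ∑₂ n (λ i j → edge i j + edge j i)
                             ≡⟨ ∑₂-cong n bothOrientations ⟨
    #adjacent                ∎
    where
    open ≡-Reasoning
    edge = λ i j → 𝟙 (isEdge< Γ i j)
    bothOrientations : ∀ i j → 𝟙 (adj Γ i j) ≡ edge i j + edge j i
    bothOrientations i j with <-cmp (toℕ i) (toℕ j)
    ... | tri< i<j _ _ rewrite <ᵇ-true i<j | <ᵇ-false (<-asym i<j) = sym (+-identityʳ _)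
    ... | tri> _ _ j<i rewrite <ᵇ-true j<i | <ᵇ-false (<-asym j<i) | adj-sym Γ i j = refl
    ... | tri≈ _ i≡j _ rewrite toℕ-injective i≡j | irrefl Γ j | ∧-zeroʳ (toℕ j <ᵇ toℕ j) = refl

  different-row : ∀ i → ∑[ j ∈ allFin n ] different i j ≡ n′
  different-row i = +-cancelʳ-≡ 1 _ _ (begin
    ∑[ j ∈ allFin n ] different i j + 1
      ≡⟨ cong (_+_ (∑[ j ∈ allFin n ] different i j)) (∑-δ-count n i) ⟨
    ∑[ j ∈ allFin n ] different i j + ∑[ j ∈ allFin n ] 𝟙 (i == j)
      ≡⟨ ∑-distrib-+ (allFin n) (different i) (λ j → 𝟙 (i == j)) ⟨
    ∑[ j ∈ allFin n ] (different i j + 𝟙 (i == j))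
      ≡⟨ ∑-cong (allFin n) (λ j → 𝟙-not (i == j)) ⟩
    ∑[ j ∈ allFin n ] 1
      ≡⟨ trans (∑-allFin-const n 1) (trans (*-identityʳ n) (+-comm 1 n′)) ⟩
    n′ + 1 ∎)
    where open ≡-Reasoning

  #differentPairs : ∑₂ n different ≡ n * n′
  #differentPairs = trans (∑-cong (allFin n) different-row) (∑-allFin-const n n′)

  #adjacent+#nonAdjacent : #adjacent + #nonAdjacent ≡ n * n′
  #adjacent+#nonAdjacent = trans (sym (∑₂-distrib-+ n (λ i j → 𝟙 (adj Γ i j)) (λ i j → different i j * nonAdjacent i j)))
                                 (trans (∑₂-cong n split) #differentPairs)
    where
    split : ∀ i j → 𝟙 (adj Γ i j) + different i j * nonAdjacent i j ≡ different i j
    split i j with i ≟ j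
    ... | yes refl rewrite irrefl Γ i = refl
    ... | no _ with adj Γ i j
    ...   | true  = refl
    ...   | false = refl

  weight+#nonSwappable : autTranspositionWeight Γ + #nonSwappable ≤ n * n′ + #nonAdjacent
  weight+#nonSwappable = subst₂ _≤_
    (∑₂-distrib-+ n (λ i j → transpositionWeight Γ i j * 𝟙 (swappable i j)) (λ i j → different i j * 𝟙 (not (swappable i j))))
    (trans (∑₂-distrib-+ n different (λ i j → different i j * nonAdjacent i j)) (cong (_+ #nonAdjacent) #differentPairs))
    (∑₂-mono n (λ i j → pointwise (i == j) (swappable i j) (adj Γ i j)))
    where
    pointwise : ∀ a b c → 𝟙 (not a) * (1 + 𝟙 (not c)) * 𝟙 b + 𝟙 (not a) * 𝟙 (not b) ≤ 𝟙 (not a) + 𝟙 (not a) * 𝟙 (not c)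
    pointwise true  _     _     = z≤n
    pointwise false true  true  = ≤-refl
    pointwise false true  false = ≤-refl
    pointwise false false true  = ≤-refl
    pointwise false false false = s≤s z≤n

  #universal+#nonUniversal : #universal + #nonUniversal ≡ n
  #universal+#nonUniversal = trans (sym (∑-distrib-+ (allFin n) (λ v → 𝟙? (universal? Γ v)) (λ v → 𝟙 (not ⌊ universal? Γ v ⌋))))
    (trans (∑-cong (allFin n) (λ v → trans (+-comm (𝟙? (universal? Γ v)) _) (𝟙-not ⌊ universal? Γ v ⌋)))
           (trans (∑-allFin-const n 1) (*-identityʳ n)))

  #nonUniversal≤#nonAdjacent : #nonUniversal ≤ #nonAdjacent
  #nonUniversal≤#nonAdjacent = ∑-mono (allFin n) row
    where
    row : ∀ v → 𝟙 (not ⌊ universal? Γ v ⌋) ≤ ∑[ k ∈ allFin n ] (different v k * nonAdjacent v k)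
    row v with universal? Γ v
    ... | yes _  = z≤n
    ... | no ¬uv with ¬universal⇒nonNeighbour Γ ¬uv
    ...   | k , k≢v , ¬avk = subst (_≤ ∑[ k ∈ allFin n ] (different v k * nonAdjacent v k)) nonAdjacentPair
                                     (term-≤-∑ n (λ k → different v k * nonAdjacent v k) k)
      where
      nonAdjacentPair : different v k * nonAdjacent v k ≡ 1
      nonAdjacentPair rewrite ==-≢ (k≢v ∘ sym) | 𝟙-not-¬T ¬avk = refl

  #universal×#nonUniversal≤#nonSwappable : #universal * #nonUniversal + #nonUniversal * #universal ≤ #nonSwappable
  #universal×#nonUniversal≤#nonSwappable = subst (_≤ #nonSwappable) split (∑-mono (allFin n) row)
    where
    u = #universal
    d = #nonUniversal
    split : ∑[ v ∈ allFin n ] (𝟙? (universal? Γ v) * d + 𝟙 (not ⌊ universal? Γ v ⌋) * u) ≡ u * d + d * u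
    split = trans (∑-distrib-+ (allFin n) (λ v → 𝟙? (universal? Γ v) * d) (λ v → 𝟙 (not ⌊ universal? Γ v ⌋) * u))
                  (cong₂ _+_ (∑-*ʳ (allFin n) d (λ v → 𝟙? (universal? Γ v))) (∑-*ʳ (allFin n) u (λ v → 𝟙 (not ⌊ universal? Γ v ⌋))))
    notSwappable : ∀ {v j} → v ≢ j → ¬ IsAut Γ (transpose v j) → 1 ≤ different v j * 𝟙 (not (swappable v j))
    notSwappable {v} {j} v≢j ¬aut with isAut? Γ (transpose v j)
    ... | yes aut = ⊥-elim (¬aut aut)
    ... | no _ rewrite ==-≢ v≢j = ≤-refl
    row : ∀ v → 𝟙? (universal? Γ v) * d + 𝟙 (not ⌊ universal? Γ v ⌋) * u
                ≤ ∑[ j ∈ allFin n ] (different v j * 𝟙 (not (swappable v j)))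
    row v with universal? Γ v
    ... | yes uv = ≤-trans (≤-reflexive (trans (+-identityʳ _) (+-identityʳ d))) (∑-mono (allFin n) column)
      where
      column : ∀ j → 𝟙 (not ⌊ universal? Γ j ⌋) ≤ different v j * 𝟙 (not (swappable v j))
      column j with universal? Γ j
      ... | yes _   = z≤n
      ... | no ¬uj  = notSwappable (λ { refl → ¬uj uv }) (¬IsAut-transpose-universal Γ uv ¬uj)
    ... | no ¬uv = ≤-trans (≤-reflexive (+-identityʳ u)) (∑-mono (allFin n) column)
      where
      column : ∀ j → 𝟙? (universal? Γ j) ≤ different v j * 𝟙 (not (swappable v j))
      column j with universal? Γ j
      ... | no _   = z≤n
      ... | yes uj = notSwappable (λ { refl → ¬uv uj })
                       (λ aut → ¬IsAut-transpose-universal Γ uj ¬uv (IsAut-cong Γ {transpose v j} {transpose j v} (transpose-comm v j) aut))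

  1≤#nonUniversal : NotComplete Γ → 1 ≤ #nonUniversal
  1≤#nonUniversal (i , j , i≢j , ¬aij) = ≤-trans iNonUniversal (term-≤-∑ n (λ v → 𝟙 (not ⌊ universal? Γ v ⌋)) i)
    where
    iNonUniversal : 1 ≤ 𝟙 (not ⌊ universal? Γ i ⌋)
    iNonUniversal with universal? Γ i
    ... | yes ui = ⊥-elim (subst T ¬aij (ui j (i≢j ∘ sym)))
    ... | no _   = ≤-refl

  module _ (nonComplete : NotComplete Γ) (2|E|≤weight : 2 * numEdges Γ ≤ autTranspositionWeight Γ) where

    #nonSwappable≤2#nonAdjacent : #nonSwappable ≤ 2 * #nonAdjacent
    #nonSwappable≤2#nonAdjacent = +-cancelˡ-≤ #adjacent _ _ (begin
      #adjacent + #nonSwappable                     ≤⟨ +-monoˡ-≤ #nonSwappable (subst (_≤ autTranspositionWeight Γ) twice-numEdges 2|E|≤weight) ⟩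
      autTranspositionWeight Γ + #nonSwappable      ≤⟨ weight+#nonSwappable ⟩
      n * n′ + #nonAdjacent                         ≡⟨ cong (_+ #nonAdjacent) #adjacent+#nonAdjacent ⟨
      (#adjacent + #nonAdjacent) + #nonAdjacent     ≡⟨ +-assoc #adjacent #nonAdjacent #nonAdjacent ⟩
      #adjacent + (#nonAdjacent + #nonAdjacent)     ≡⟨ cong (λ k → #adjacent + (#nonAdjacent + k)) (+-identityʳ _) ⟨
      #adjacent + 2 * #nonAdjacent                  ∎)
      where open ≤-Reasoning

    #universal*#nonUniversal≤#nonAdjacent : #universal * #nonUniversal ≤ #nonAdjacent
    #universal*#nonUniversal≤#nonAdjacent = *-cancelˡ-≤ 2 (begin
      2 * (#universal * #nonUniversal)
        ≡⟨ cong (λ k → #universal * #nonUniversal + k) (trans (+-identityʳ _) (*-comm #universal #nonUniversal)) ⟩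
      #universal * #nonUniversal + #nonUniversal * #universal
        ≤⟨ #universal×#nonUniversal≤#nonSwappable ⟩
      #nonSwappable
        ≤⟨ #nonSwappable≤2#nonAdjacent ⟩
      2 * #nonAdjacent ∎)
      where open ≤-Reasoning

    n′≤#nonAdjacent : n′ ≤ #nonAdjacent
    n′≤#nonAdjacent = ≤-pred (subst (_≤ suc #nonAdjacent) #universal+#nonUniversal
      (u+d≤1+N #universal #nonUniversal #nonAdjacent (1≤#nonUniversal nonComplete) #nonUniversal≤#nonAdjacent
               #universal*#nonUniversal≤#nonAdjacent))

    twice-numEdges≤square : 2 * numEdges Γ ≤ n′ * n′
    twice-numEdges≤square = +-cancelʳ-≤ n′ _ _ (begin
      2 * numEdges Γ + n′            ≤⟨ +-monoʳ-≤ (2 * numEdges Γ) n′≤#nonAdjacent ⟩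
      2 * numEdges Γ + #nonAdjacent  ≡⟨ cong (_+ #nonAdjacent) twice-numEdges ⟩
      #adjacent + #nonAdjacent       ≡⟨ #adjacent+#nonAdjacent ⟩
      n′ + n′ * n′                   ≡⟨ +-comm n′ (n′ * n′) ⟩
      n′ * n′ + n′                   ∎)
      where open ≤-Reasoning

signedPower : ℕ → ℕ → ℕ → ℤ
signedPower n x c = (- + 1) ℤ.^ n ℤ.* (- + x) ℤ.^ c

infix 4 _≡±_
_≡±_ : ℤ → ℕ → Set
z ≡± k = z ≡ + k ⊎ z ≡ - + k

≡±-* : ∀ {z w k l} → z ≡± k → w ≡± l → z ℤ.* w ≡± k * l
≡±-* {k = k} {l} (inj₁ refl) (inj₁ refl) = inj₁ (sym (ℤ.pos-* k l))
≡±-* {k = k} {l} (inj₁ refl) (inj₂ refl) = inj₂ (trans (sym (ℤ.neg-distribʳ-* (+ k) (+ l))) (cong -_ (sym (ℤ.pos-* k l))))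
≡±-* {k = k} {l} (inj₂ refl) (inj₁ refl) = inj₂ (trans (sym (ℤ.neg-distribˡ-* (+ k) (+ l))) (cong -_ (sym (ℤ.pos-* k l))))
≡±-* {k = k} {l} (inj₂ refl) (inj₂ refl) = inj₁ (trans (sym (ℤ.neg-distribˡ-* (+ k) (- + l)))
  (trans (cong -_ (sym (ℤ.neg-distribʳ-* (+ k) (+ l)))) (trans (ℤ.neg-involutive _) (sym (ℤ.pos-* k l)))))

≡±-^ : ∀ {z k} → z ≡± k → ∀ c → z ℤ.^ c ≡± k ^ c
≡±-^ z≡±k zero    = inj₁ refl
≡±-^ z≡±k (suc c) = ≡±-* z≡±k (≡±-^ z≡±k c)

≡±⇒≥ : ∀ {z k} → z ≡± k → - + k ℤ.≤ z
≡±⇒≥ (inj₁ refl) = ℤ.neg-≤-pos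
≡±⇒≥ (inj₂ refl) = ℤ.≤-refl

signedPower-≥ : ∀ n x c e → 1 ≤ x → c ≤ e → - + (x ^ e) ℤ.≤ signedPower n x c
signedPower-≥ n x c e 1≤x c≤e = ℤ.≤-trans (ℤ.neg-mono-≤ (+≤+ (^-monoʳ-≤ x c≤e)))
  (≡±⇒≥ (subst (signedPower n x c ≡±_) (*-identityˡ (x ^ c))
              (≡±-* (subst ((- + 1) ℤ.^ n ≡±_) (^-zeroˡ n) (≡±-^ (inj₂ refl) n)) (≡±-^ (inj₂ refl) c))))
  where instance _ = >-nonZero 1≤x

signedPower-self : ∀ n x → signedPower n x n ≡ + (x ^ n)
signedPower-self zero    x = refl
signedPower-self (suc n) x = begin
  ((- + 1) ℤ.* (- + 1) ℤ.^ n) ℤ.* ((- + x) ℤ.* (- + x) ℤ.^ n)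
    ≡⟨ CommutativeSemigroupProperties.interchange ℤ.*-commutativeSemigroup (- + 1) ((- + 1) ℤ.^ n) (- + x) ((- + x) ℤ.^ n) ⟩
  ((- + 1) ℤ.* (- + x)) ℤ.* signedPower n x n
    ≡⟨ cong₂ ℤ._*_ (trans (ℤ.-1*i≡-i (- + x)) (ℤ.neg-involutive (+ x))) (signedPower-self n x) ⟩
  + x ℤ.* + (x ^ n)
    ≡⟨ ℤ.pos-* x (x ^ n) ⟨
  + (x ^ suc n) ∎
  where open ≡-Reasoning

∑ℤ : ∀ {A : Set} → List A → (A → ℤ) → ℤ
∑ℤ []       f = + 0
∑ℤ (a ∷ as) f = f a ℤ.+ ∑ℤ as f

module _ {A : Set} where

  ∑ℤ-pos : ∀ (L : List A) (f : A → ℕ) → ∑ℤ L (λ a → + f a) ≡ + ∑ L f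
  ∑ℤ-pos []      f = refl
  ∑ℤ-pos (a ∷ L) f = trans (cong (ℤ._+_ (+ f a)) (∑ℤ-pos L f)) (sym (ℤ.pos-+ (f a) (∑ L f)))

  ∑ℤ-distrib-+ : ∀ (L : List A) (f g : A → ℤ) → ∑ℤ L (λ a → f a ℤ.+ g a) ≡ ∑ℤ L f ℤ.+ ∑ℤ L g
  ∑ℤ-distrib-+ []      f g = refl
  ∑ℤ-distrib-+ (a ∷ L) f g rewrite ∑ℤ-distrib-+ L f g =
    CommutativeSemigroupProperties.interchange ℤ.+-commutativeSemigroup (f a) (g a) (∑ℤ L f) (∑ℤ L g)

  ∑ℤ-*ˡ : ∀ (L : List A) k (f : A → ℤ) → ∑ℤ L (λ a → k ℤ.* f a) ≡ k ℤ.* ∑ℤ L f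
  ∑ℤ-*ˡ []      k f = sym (ℤ.*-zeroʳ k)
  ∑ℤ-*ˡ (a ∷ L) k f rewrite ∑ℤ-*ˡ L k f = sym (ℤ.*-distribˡ-+ k (f a) (∑ℤ L f))

  ∑ℤ-mono : ∀ (L : List A) {f g : A → ℤ} → (∀ a → f a ℤ.≤ g a) → ∑ℤ L f ℤ.≤ ∑ℤ L g
  ∑ℤ-mono []      h = ℤ.≤-refl
  ∑ℤ-mono (a ∷ L) h = ℤ.+-mono-≤ (h a) (∑ℤ-mono L h)

transpositionWeightOf : ∀ {n} → Graph n → Perm n → ℕ
transpositionWeightOf {n} Γ g = ∑₂ n (λ i j → transpositionWeight Γ i j * 𝟙? (g ≟ₚ transpose i j))

module _ {n : ℕ} (Γ : Graph n) where

  #occurrences≤isAut : ∀ (τ : Perm n) (G : List (Perm n)) → All (IsAut Γ) G → AllPairs (λ σ ρ → ¬ σ ≈ₚ ρ) G →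
    ∑[ g ∈ G ] 𝟙? (g ≟ₚ τ) ≤ 𝟙? (isAut? Γ τ)
  #occurrences≤isAut τ []      _             _             = z≤n
  #occurrences≤isAut τ (g ∷ G) (autg ∷ autG) (g≉G ∷ distinctG) with g ≟ₚ τ
  ... | no _ = #occurrences≤isAut τ G autG distinctG
  ... | yes g≈τ with isAut? Γ τ
  ...   | no ¬autτ = ⊥-elim (¬autτ (IsAut-cong Γ {g} {τ} g≈τ autg))
  ...   | yes _    = s≤s (≤-reflexive (∑-All-zero G (λ ρ → 𝟙? (ρ ≟ₚ τ))
                       (All.map (λ {ρ} g≉ρ → 𝟙?-no (ρ ≟ₚ τ) (λ ρ≈τ → g≉ρ (λ i → trans (g≈τ i) (sym (ρ≈τ i))))) g≉G)))

  ∑-transpositionWeightOf≤autTranspositionWeight : ∀ (G : List (Perm n)) → All (IsAut Γ) G → AllPairs (λ σ ρ → ¬ σ ≈ₚ ρ) G →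
    ∑[ g ∈ G ] transpositionWeightOf Γ g ≤ autTranspositionWeight Γ
  ∑-transpositionWeightOf≤autTranspositionWeight G autG distinctG = begin
    ∑[ g ∈ G ] transpositionWeightOf Γ g
      ≡⟨ ∑-∑₂-comm G n (λ g i j → transpositionWeight Γ i j * 𝟙? (g ≟ₚ transpose i j)) ⟩
    ∑₂ n (λ i j → ∑[ g ∈ G ] (transpositionWeight Γ i j * 𝟙? (g ≟ₚ transpose i j)))
      ≡⟨ ∑₂-cong n (λ i j → ∑-*ˡ G (transpositionWeight Γ i j) (λ g → 𝟙? (g ≟ₚ transpose i j))) ⟩
    ∑₂ n (λ i j → transpositionWeight Γ i j * ∑[ g ∈ G ] 𝟙? (g ≟ₚ transpose i j))
      ≤⟨ ∑₂-mono n (λ i j → *-monoʳ-≤ (transpositionWeight Γ i j) (#occurrences≤isAut (transpose i j) G autG distinctG)) ⟩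
    autTranspositionWeight Γ ∎
    where open ≤-Reasoning

  reciprocal-∑ : ∀ {G} → Reciprocal Γ G → ∀ x →
    + ∑[ g ∈ G ] chromQuot Γ g x ≡ ∑ℤ G (λ g → signedPower n x (numCycles g))
  reciprocal-∑ {G} reciprocal x = trans (cong +_ (sym (chromPair≡∑ G))) (trans (reciprocal x)
    (trans (cong ((- + 1) ℤ.^ n ℤ.*_) (cycleIndexF≡∑ℤ G)) (sym (∑ℤ-*ˡ G ((- + 1) ℤ.^ n) _))))
    where
    chromPair≡∑ : ∀ G → chromPair Γ G x ≡ ∑[ g ∈ G ] chromQuot Γ g x
    chromPair≡∑ []      = refl
    chromPair≡∑ (g ∷ G) = cong (_+_ (chromQuot Γ g x)) (chromPair≡∑ G)
    cycleIndexF≡∑ℤ : ∀ G → cycleIndexF G (- + x) ≡ ∑ℤ G (λ g → (- + x) ℤ.^ numCycles g)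
    cycleIndexF≡∑ℤ []      = refl
    cycleIndexF≡∑ℤ (g ∷ G) = cong (ℤ._+_ ((- + x) ℤ.^ numCycles g)) (cycleIndexF≡∑ℤ G)

≤-2s+B : ∀ {s} Y A B → - + Y ℤ.≤ s → A + 2 * Y ≤ B → + A ℤ.≤ + 2 ℤ.* s ℤ.+ + B
≤-2s+B {s} Y A B -Y≤s A+2Y≤B = begin
  + A                    ≤⟨ +≤+ (m+n≤o⇒m≤o∸n A A+2Y≤B) ⟩
  + (B ∸ 2 * Y)          ≡⟨ ℤ.⊖-≥ (≤-trans (m≤n+m (2 * Y) A) A+2Y≤B) ⟨
  B ℤ.⊖ 2 * Y            ≡⟨ ℤ.-m+n≡n⊖m (2 * Y) B ⟨
  - + (2 * Y) ℤ.+ + B    ≤⟨ ℤ.+-monoˡ-≤ (+ B) (ℤ.≤-trans (ℤ.≤-reflexive -2Y≡2*-Y) (ℤ.*-monoˡ-≤-nonNeg (+ 2) -Y≤s)) ⟩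
  + 2 ℤ.* s ℤ.+ + B      ∎
  where
  open ℤ.≤-Reasoning
  -2Y≡2*-Y : - + (2 * Y) ≡ + 2 ℤ.* - + Y
  -2Y≡2*-Y = trans (cong -_ (ℤ.pos-* 2 Y)) (ℤ.neg-distribʳ-* (+ 2) (+ Y))

≤-2X+B : ∀ X A B → A ≤ 2 * X + B → + A ℤ.≤ + 2 ℤ.* + X ℤ.+ + B
≤-2X+B X A B le = ℤ.≤-trans (+≤+ le) (ℤ.≤-reflexive (trans (ℤ.pos-+ (2 * X) B) (cong (ℤ._+ + B) (ℤ.pos-* 2 X))))

module Coefficients {m : ℕ} (Γ : Graph (suc (suc m))) (x : ℕ) (1≤x : 1 ≤ x) where

  private
    n = suc (suc m)
    M = numEdges Γ
    X₁ = x ^ suc m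
    X₀ = x ^ m

  -- Both sides of PerPermutation g have the same terms of degree n and n − 1; K xⁿ⁻² absorbs the
  -- lower terms 2|E|² xⁿ⁻² (identity) and 4 xⁿ⁻² (permutations with at most n − 2 cycles).
  K : ℕ
  K = 2 * (M * M + 2)

  lhs rhs : Perm n → ℕ
  lhs g = 2 * chromQuot Γ g x + 𝟙? (g ≟ₚ id) * (2 * M * X₁)
  rhs g = transpositionWeightOf Γ g * X₁ + K * X₀

  PerPermutation : Perm n → Set
  PerPermutation g = + lhs g ℤ.≤ + 2 ℤ.* signedPower n x (numCycles g) ℤ.+ + rhs g

  perPermutation-identity : ∀ g → (∀ i → g ⟨$⟩ʳ i ≡ i) → PerPermutation g
  perPermutation-identity g fixes =
    subst (λ s → + lhs g ℤ.≤ + 2 ℤ.* s ℤ.+ + rhs g) (sym (trans (cong (signedPower n x) (numCycles-id g fixes)) (signedPower-self n x)))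
      (≤-2X+B (x ^ n) (lhs g) (rhs g) (begin
        2 * P + 𝟙? (g ≟ₚ id) * (2 * M * X₁)   ≡⟨ cong (λ b → 2 * P + b * (2 * M * X₁)) (𝟙?-yes (g ≟ₚ id) fixes) ⟩
        2 * P + 1 * (2 * M * X₁)             ≡⟨ double-sum P M X₁ ⟩
        2 * (P + M * X₁)                     ≤⟨ *-monoʳ-≤ 2 (Bonferroni.bonferroni Γ g x) ⟩
        2 * (x ^ n + M * M * X₀)             ≡⟨ *-distribˡ-+ 2 (x ^ n) (M * M * X₀) ⟩
        2 * x ^ n + 2 * (M * M * X₀)         ≤⟨ +-monoʳ-≤ (2 * x ^ n) (≤-trans squareTerm (m≤n+m (K * X₀) _)) ⟩
        2 * x ^ n + rhs g                    ∎))
    where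
    open ≤-Reasoning
    P = chromQuot Γ g x
    double-sum : ∀ a b c → 2 * a + 1 * (2 * b * c) ≡ 2 * (a + b * c)
    double-sum = solve-∀
    squareTerm : 2 * (M * M * X₀) ≤ K * X₀
    squareTerm = ≤-trans (≤-reflexive (sym (*-assoc 2 (M * M) X₀))) (*-monoˡ-≤ X₀ (*-monoʳ-≤ 2 (m≤m+n (M * M) 2)))

  lhs-moved : ∀ g {i} → g ⟨$⟩ʳ i ≢ i → lhs g ≡ 2 * chromQuot Γ g x
  lhs-moved g {i} gi≢i = trans (cong (λ b → 2 * chromQuot Γ g x + b * (2 * M * X₁)) (𝟙?-no (g ≟ₚ id) (λ g≈id → gi≢i (g≈id i))))
                               (+-identityʳ _)

  perPermutation-transposition : ∀ g i → g ⟨$⟩ʳ i ≢ i → g ≈ₚ transpose i (g ⟨$⟩ʳ i) → numCycles g + 1 ≤ n → PerPermutation g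
  perPermutation-transposition g i gi≢i g≈τ cycles =
    ≤-2s+B X₁ (lhs g) (rhs g) (signedPower-≥ n x (numCycles g) (suc m) 1≤x (≤-pred (subst (_≤ n) (+-comm _ 1) cycles))) (begin
      lhs g + 2 * X₁                            ≡⟨ cong (_+ 2 * X₁) (lhs-moved g gi≢i) ⟩
      2 * chromQuot Γ g x + 2 * X₁              ≤⟨ +-monoˡ-≤ (2 * X₁) (*-monoʳ-≤ 2 chromQuot≤) ⟩
      2 * (na * X₁) + 2 * X₁                    ≡⟨ regroup na X₁ ⟩
      ((1 + na) + (1 + na)) * X₁                ≡⟨ cong (_* X₁) (cong₂ _+_ weight-ij weight-ji) ⟨
      (transpositionWeight Γ i j + transpositionWeight Γ j i) * X₁
                                                ≤⟨ *-monoˡ-≤ X₁ weight≤ ⟩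
      transpositionWeightOf Γ g * X₁            ≤⟨ m≤m+n _ (K * X₀) ⟩
      rhs g                                     ∎)
    where
    open ≤-Reasoning
    j = g ⟨$⟩ʳ i
    i≢j : i ≢ j
    i≢j = gi≢i ∘ sym
    na = 𝟙 (not (adj Γ i j))
    chromQuot≤ : chromQuot Γ g x ≤ na * X₁
    chromQuot≤ with adj Γ i j in e
    ... | true  = ≤-reflexive (chromQuot-loop {x = x} Γ g (s≤s (s≤s z≤n)) (subst T (sym e) _))
    ... | false = ≤-trans (chromQuot-moved {x = x} Γ g gi≢i) (≤-reflexive (sym (+-identityʳ X₁)))
    weight-ij : transpositionWeight Γ i j ≡ 1 + na
    weight-ij rewrite ==-≢ i≢j = +-identityʳ _
    weight-ji : transpositionWeight Γ j i ≡ 1 + na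
    weight-ji rewrite ==-≢ gi≢i | adj-sym Γ j i = +-identityʳ _
    regroup : ∀ a y → 2 * (a * y) + 2 * y ≡ ((1 + a) + (1 + a)) * y
    regroup = solve-∀
    selected : ∀ a b → g ≈ₚ transpose a b → transpositionWeight Γ a b ≡ transpositionWeight Γ a b * 𝟙? (g ≟ₚ transpose a b)
    selected a b g≈τab = trans (sym (*-identityʳ _)) (cong (transpositionWeight Γ a b *_) (sym (𝟙?-yes (g ≟ₚ transpose a b) g≈τab)))
    weight≤ : transpositionWeight Γ i j + transpositionWeight Γ j i ≤ transpositionWeightOf Γ g
    weight≤ = ≤-trans (≤-reflexive (cong₂ _+_ (selected i j g≈τ) (selected j i (λ k → trans (g≈τ k) (transpose-comm i j k)))))
                      (twoTerms-≤-∑₂ n (λ a b → transpositionWeight Γ a b * 𝟙? (g ≟ₚ transpose a b)) i j i≢j)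

  perPermutation-twoMoved : ∀ g i k → i ≢ g ⟨$⟩ʳ i → i ≢ g ⟨$⟩ʳ k → i ≢ k → g ⟨$⟩ʳ k ≢ k →
    numCycles g + 2 ≤ n → PerPermutation g
  perPermutation-twoMoved g i k i≢gi i≢gk i≢k gk≢k cycles =
    ≤-2s+B X₀ (lhs g) (rhs g) (signedPower-≥ n x (numCycles g) m 1≤x (≤-pred (≤-pred (subst (_≤ n) (+-comm _ 2) cycles)))) (begin
      lhs g + 2 * X₀                  ≡⟨ cong (_+ 2 * X₀) (lhs-moved g (i≢gi ∘ sym)) ⟩
      2 * chromQuot Γ g x + 2 * X₀    ≤⟨ +-monoˡ-≤ (2 * X₀) (*-monoʳ-≤ 2 (chromQuot-twoMoved Γ g i≢gi i≢gk i≢k gk≢k)) ⟩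
      2 * X₀ + 2 * X₀                 ≡⟨ *-distribʳ-+ X₀ 2 2 ⟨
      4 * X₀                          ≤⟨ *-monoˡ-≤ X₀ (*-monoʳ-≤ 2 (m≤n+m 2 (M * M))) ⟩
      K * X₀                          ≤⟨ m≤n+m (K * X₀) _ ⟩
      rhs g                           ∎)
    where open ≤-Reasoning

  perPermutation : ∀ g → PerPermutation g
  perPermutation g with shape g
  ... | identity fixes                          = perPermutation-identity g fixes
  ... | transposition i gi≢i g≈τ cycles         = perPermutation-transposition g i gi≢i g≈τ cycles
  ... | twoMoved i k i≢gi i≢gk i≢k gk≢k cycles = perPermutation-twoMoved g i k i≢gi i≢gk i≢k gk≢k cycles

  ∑-perPermutation : ∀ {G} → Reciprocal Γ G → ∑[ g ∈ G ] (𝟙? (g ≟ₚ id) * (2 * M * X₁)) ≤ ∑[ g ∈ G ] rhs g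
  ∑-perPermutation {G} reciprocal = +-cancelˡ-≤ (2 * P) _ _ (subst (_≤ 2 * P + ∑ G rhs) ∑-lhs (ℤ.drop‿+≤+ (begin
    + ∑ G lhs                                                ≡⟨ ∑ℤ-pos G lhs ⟨
    ∑ℤ G (λ g → + lhs g)                                     ≤⟨ ∑ℤ-mono G perPermutation ⟩
    ∑ℤ G (λ g → + 2 ℤ.* signedPower n x (numCycles g) ℤ.+ + rhs g)
                                                             ≡⟨ ∑ℤ-distrib-+ G _ (λ g → + rhs g) ⟩
    ∑ℤ G (λ g → + 2 ℤ.* signedPower n x (numCycles g)) ℤ.+ ∑ℤ G (λ g → + rhs g)
                                                             ≡⟨ cong₂ ℤ._+_ (∑ℤ-*ˡ G (+ 2) _) (∑ℤ-pos G rhs) ⟩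
    + 2 ℤ.* ∑ℤ G (λ g → signedPower n x (numCycles g)) ℤ.+ + ∑ G rhs
                                                             ≡⟨ cong (λ z → + 2 ℤ.* z ℤ.+ + ∑ G rhs) (reciprocal-∑ Γ {G} reciprocal x) ⟨
    + 2 ℤ.* + P ℤ.+ + ∑ G rhs                               ≡⟨ trans (ℤ.pos-+ (2 * P) (∑ G rhs)) (cong (ℤ._+ + ∑ G rhs) (ℤ.pos-* 2 P)) ⟨
    + (2 * P + ∑ G rhs)                                      ∎)))
    where
    open ℤ.≤-Reasoning
    P = ∑[ g ∈ G ] chromQuot Γ g x
    ∑-lhs : ∑ G lhs ≡ 2 * P + ∑[ g ∈ G ] (𝟙? (g ≟ₚ id) * (2 * M * X₁))
    ∑-lhs = trans (∑-distrib-+ G _ _) (cong (_+ ∑[ g ∈ G ] (𝟙? (g ≟ₚ id) * (2 * M * X₁))) (∑-*ˡ G 2 (λ g → chromQuot Γ g x)))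

-- Taking x = C + 1 makes the lower-order term C xᵐ smaller than xᵐ⁺¹.
leadingCoefficient-≤ : ∀ a b C m → (∀ x → 1 ≤ x → a * x ^ suc m ≤ b * x ^ suc m + C * x ^ m) → a ≤ b
leadingCoefficient-≤ a b C m bound = ≮⇒≥ λ b<a → 1+n≰n (+-cancelʳ-≤ (b * x) x C (begin
  x + b * x    ≤⟨ *-monoˡ-≤ x b<a ⟩
  a * x        ≤⟨ ax≤bx+C ⟩
  b * x + C    ≡⟨ +-comm (b * x) C ⟩
  C + b * x    ∎))
  where
  open ≤-Reasoning
  x = suc C
  instance _ = m^n≢0 x m
  ax≤bx+C : a * x ≤ b * x + C
  ax≤bx+C = *-cancelʳ-≤ (a * x) (b * x + C) (x ^ m) (subst₂ _≤_ (factor a x (x ^ m)) (factor+ b x C (x ^ m)) (bound x (s≤s z≤n)))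
    where
    factor : ∀ a x y → a * (x * y) ≡ a * x * y
    factor = solve-∀
    factor+ : ∀ b x C y → b * (x * y) + C * y ≡ (b * x + C) * y
    factor+ = solve-∀

twice-numEdges≤∑transpositionWeightOf : ∀ {m} (Γ : Graph (suc (suc m))) (G : List (Perm (suc (suc m)))) →
  IsAutSubgroup Γ G → Reciprocal Γ G → 2 * numEdges Γ ≤ ∑[ g ∈ G ] transpositionWeightOf Γ g
twice-numEdges≤∑transpositionWeightOf {m} Γ G subgroup reciprocal =
  leadingCoefficient-≤ (2 * M) (∑ G (transpositionWeightOf Γ)) (length G * (2 * (M * M + 2))) m bound
  where
  M = numEdges Γ
  bound : ∀ x → 1 ≤ x → 2 * M * x ^ suc m ≤ ∑ G (transpositionWeightOf Γ) * x ^ suc m + length G * (2 * (M * M + 2)) * x ^ m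
  bound x 1≤x = begin
    2 * M * X₁                                              ≡⟨ *-identityˡ (2 * M * X₁) ⟨
    1 * (2 * M * X₁)                                        ≤⟨ *-monoˡ-≤ (2 * M * X₁) 1≤#identities ⟩
    ∑[ g ∈ G ] 𝟙? (g ≟ₚ id) * (2 * M * X₁)                  ≡⟨ ∑-*ʳ G (2 * M * X₁) (λ g → 𝟙? (g ≟ₚ id)) ⟨
    ∑[ g ∈ G ] (𝟙? (g ≟ₚ id) * (2 * M * X₁))                ≤⟨ ∑-perPermutation {G} reciprocal ⟩
    ∑ G rhs                                                 ≡⟨ ∑-distrib-+ G (λ g → transpositionWeightOf Γ g * X₁) (λ _ → K * X₀) ⟩
    ∑[ g ∈ G ] (transpositionWeightOf Γ g * X₁) + ∑[ _ ∈ G ] (K * X₀)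
                                                            ≡⟨ cong₂ _+_ (∑-*ʳ G X₁ (transpositionWeightOf Γ)) (trans (∑-const G (K * X₀)) (sym (*-assoc (length G) K X₀))) ⟩
    ∑ G (transpositionWeightOf Γ) * X₁ + length G * K * X₀  ∎
    where
    open ≤-Reasoning
    open Coefficients Γ x 1≤x
    X₁ = x ^ suc m
    X₀ = x ^ m
    1≤#identities : 1 ≤ ∑[ g ∈ G ] 𝟙? (g ≟ₚ id)
    1≤#identities = 1≤∑ G (λ g → 𝟙? (g ≟ₚ id)) (has-id subgroup) (λ {g} g≈id → ≤-reflexive (sym (𝟙?-yes (g ≟ₚ id) g≈id)))

mainTheorem16 : (n : ℕ) (Γ : Graph n) (G : List (Perm n)) →
    NotComplete Γ → IsAutSubgroup Γ G → Reciprocal Γ G →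
    2 * numEdges Γ ≤ (n ∸ 1) * (n ∸ 1)
mainTheorem16 zero          Γ G (() , _) _ _
mainTheorem16 (suc zero)    Γ G (fzero , fzero , 0≢0 , _) _ _ = ⊥-elim (0≢0 refl)
mainTheorem16 (suc (suc m)) Γ G nonComplete subgroup reciprocal =
  PairCounts.twice-numEdges≤square Γ nonComplete (≤-trans
    (twice-numEdges≤∑transpositionWeightOf Γ G subgroup reciprocal)
    (∑-transpositionWeightOf≤autTranspositionWeight Γ G (all-aut subgroup) (distinct subgroup)))
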